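{- Let $\mathcal{A}$ be a lazy stable paging algorithm and suppose $\alpha=\omega(\log k)$ (with $\alpha\mid k$, $\alpha<k$). Then $\alpha$-way set-associative $\mathcal{A}$ is $1$-competitive with $\mathcal{A}$ with high probability using $(1+\Theta(\sqrt{\log(k)/\alpha}))$-resource augmentation on request sequences of length $\operatorname{poly}(k)$.
   Context: Paging: $\mathcal{U}$ is a universe of items; a request sequence is $\sigma\in\mathcal{U}^*$. For a paging algorithm $\mathcal{A}$ and cache size $k$, $\mathcal{A}_k$ denotes $\mathcal{A}$ run on an initially empty cache of $k$ slots; $C(\mathcal{A}_k,\sigma)$ is its number of cache misses on $\sigma$; $\mathcal{A}_k(\sigma)$ is the set of items cached after serving $\sigma$; $\textsf{Out}(\mathcal{A}_k,\sigma,x):=\mathcal{A}_k(\sigma)\setminus\mathcal{A}_k(\sigma x)$; for $X\subseteq\mathcal{U}$, $\sigma[X]$ is the subsequence of requests to items in $X$. Lazy: fetches only on a miss, evicts at most one item per miss, and only when full. Stable: for every $\tau\in\mathcal{U}^*$, $X\subseteq\mathcal{U}$, $z\in X$, integers $a>b\ge1$, $\textsf{Out}(\mathcal{A}_b,\tau[X],z)\cap\mathcal{A}_a(\tau z)\neq\emptyset$ implies $\mathcal{A}_b(\tau[X]z)\subseteq\mathcal{A}_a(\tau z)$. $\alpha$-way set-associative $\mathcal{A}$ with cache size $k$: pick a fully random hash $h:\mathcal{U}\to[k/\alpha]$, split the cache into $k/\alpha$ buckets of $\alpha$ slots each running an independent $\mathcal{A}_\alpha$, and serve request $x$ in bucket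 $h(x)$. $\mathcal{A}$ is $c$-competitive with $\mathcal{B}$ with probability $p$ using $r$-resource augmentation on sequences of length $\ell$ if for all $\sigma$ with $|\sigma|\le\ell$, $\Pr[C(\mathcal{A}_k,\sigma)\le c\,C(\mathcal{B}_{k'},\sigma)+O(1)]\ge p$ with $k=rk'$ (oblivious adversary; randomness over the hash). "With high probability" means with probability $1-1/\operatorname{poly}(k)$, and "$\operatorname{poly}(k)$" means any polynomial in $k$, provided hidden constants are chosen appropriately. -}

module Defs where

open import Data.Bool using (Bool; true; false; if_then_else_; not)
open import Data.Nat using (ℕ; zero; suc; _+_; _*_; _≤_; _<_; _≤ᵇ_; NonZero)
open import Data.Fin using (Fin)
import Data.Fin as Fin
open import Data.List using (List; []; _∷_; _∷ʳ_; length; map; concatMap; allFin; filterᵇ; deduplicate)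
open import Data.Nat.ListAction using (sum)
open import Data.List.Membership.Propositional using (_∈_; _∉_)
open import Data.List.Relation.Unary.Unique.Propositional using (Unique)
open import Data.Product using (Σ; _×_; ∃)
open import Data.Sum using (_⊎_)
open import Relation.Binary.PropositionalEquality using (_≡_)
open import Relation.Binary.Definitions using (DecidableEquality)
open import Relation.Nullary using (¬_; does)
open import Function.Bundles using (_⇔_)
import Data.List.Membership.DecPropositional as DecMem

module Paging {U : Set} (_≟U_ : DecidableEquality U) where

  open DecMem _≟U_ using (_∈?_)

  -- A (deterministic, online) paging algorithm: for each cache size k and each
  -- request sequence σ, the set of items cached by A_k after serving σ
  -- (starting from the empty cache).
  record PagingAlg : Set where
    field
      cache      : ℕ → List U → List U
      cache-uniq : ∀ k σ → Unique (cache k σ)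
      cache-size : ∀ k σ → length (cache k σ) ≤ k
  open PagingAlg public

  missesFrom : PagingAlg → ℕ → List U → List U → ℕ
  missesFrom A k pre []       = 0
  missesFrom A k pre (x ∷ xs) =
    (if does (x ∈? cache A k pre) then 0 else 1) + missesFrom A k (pre ∷ʳ x) xs

  cost : PagingAlg → ℕ → List U → ℕ
  cost A k σ = missesFrom A k [] σ

  record Lazy (A : PagingAlg) : Set where
    field
      empty   : ∀ k y → y ∉ cache A k []
      hit     : ∀ k → .{{NonZero k}} → ∀ σ x → x ∈ cache A k σ →
                ∀ y → (y ∈ cache A k (σ ∷ʳ x)) ⇔ (y ∈ cache A k σ)
      fetch   : ∀ k → .{{NonZero k}} → ∀ σ x → x ∉ cache A k σ →
                x ∈ cache A k (σ ∷ʳ x)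
      only-x  : ∀ k → .{{NonZero k}} → ∀ σ x → x ∉ cache A k σ →
                ∀ y → y ∈ cache A k (σ ∷ʳ x) → y ≡ x ⊎ y ∈ cache A k σ
      one-out : ∀ k → .{{NonZero k}} → ∀ σ x → x ∉ cache A k σ → ∀ y z →
                y ∈ cache A k σ → y ∉ cache A k (σ ∷ʳ x) →
                z ∈ cache A k σ → z ∉ cache A k (σ ∷ʳ x) → y ≡ z
      full    : ∀ k → .{{NonZero k}} → ∀ σ x → x ∉ cache A k σ → ∀ y →
                y ∈ cache A k σ → y ∉ cache A k (σ ∷ʳ x) →
                length (cache A k σ) ≡ k

  restrict : (U → Bool) → List U → List U
  restrict X σ = filterᵇ X σ

  InOut : PagingAlg → ℕ → List U → U → U → Set
  InOut A k σ z y = y ∈ cache A k σ × y ∉ cache A k (σ ∷ʳ z)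

  Stable : PagingAlg → Set
  Stable A = ∀ (τ : List U) (X : U → Bool) (z : U) → X z ≡ true →
             ∀ (a b : ℕ) → b < a → 1 ≤ b →
             (∃ λ y → InOut A b (restrict X τ) z y × y ∈ cache A a (τ ∷ʳ z)) →
             ∀ y → y ∈ cache A b (restrict X τ ∷ʳ z) → y ∈ cache A a (τ ∷ʳ z)

  -- A hash on the distinct items of σ: the i-th distinct item (in order of
  -- first occurrence) gets the i-th entry of the list h.
  -- inBucket items h j x : does x hash to bucket j?
  inBucket : ∀ {q} → List U → List (Fin q) → Fin q → U → Bool
  inBucket []       _        j x = false
  inBucket (y ∷ ys) []       j x = false
  inBucket (y ∷ ys) (c ∷ cs) j x =
    if does (x ≟U y) then does (c Fin.≟ j) else inBucket ys cs j x

  items : List U → List U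
  items σ = deduplicate _≟U_ σ

  saCost : PagingAlg → (q α : ℕ) → List (Fin q) → List U → ℕ
  saCost A q α h σ =
    sum (map (λ j → cost A α (restrict (inBucket (items σ) h j) σ)) (allFin q))

-- all lists of length m over Fin q (the q^m equally likely hash functions)
allHashes : (q m : ℕ) → List (List (Fin q))
allHashes q zero    = [] ∷ []
allHashes q (suc m) = concatMap (λ c → map (c ∷_) (allHashes q m)) (allFin q)

countᵇ : ∀ {A : Set} → (A → Bool) → List A → ℕ
countᵇ p xs = length (filterᵇ p xs)

module Submission where

-- Write q = k / α for the number of buckets and a = max(α + 1, k'). Stability yields the inclusion
-- property A_{k'}(τ) ⊆ A_a(τ) and, as long as no bucket ever holds more than α of the items of A_a(τ),
-- also A_a(τ) ∩ bucket ⊆ A_α(τ[bucket]). Then every hit of A_{k'} is a hit in its bucket and every miss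
-- of A_{k'} costs at most one bucket miss, so the set-associative cache misses no more than A_{k'}.
-- A bucket receives on average at most c ≈ a / q of the items of A_a(τ); weighting each hash by
-- (1 + 1/Q) ^ load (a Chernoff bound) shows that at most a 2 ^ (−Ω(D² / c)) fraction of the hashes put
-- α + 1 = c + D of them into a given bucket. The hypotheses on α and k' make D² / c = Ω(log k), so a
-- union bound over the |σ| + 1 prefixes of σ and the q buckets leaves a fraction below 1 / k ^ e.

open import Defs
import Algebra.Properties.CommutativeSemigroup as CommutativeSemigroupProperties
open import Data.Bool using (Bool; true; false; T; not; _∧_; _∨_; if_then_else_)
open import Data.Bool.ListAction using (any)
open import Data.Bool.Properties using (T-≡; T-∧; T-∨)
open import Data.Empty using (⊥; ⊥-elim)
open import Data.Fin using (Fin)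
import Data.Fin as Fin
open import Data.List using (List; []; _∷_; _∷ʳ_; _++_; length; map; concatMap; filter; filterᵇ; allFin; inits)
open import Data.List.Membership.Propositional using (_∈_; _∉_; find)
import Data.List.Membership.DecPropositional as DecMembership
open import Data.List.Membership.Propositional.Properties
  using (∈-++⁺ˡ; ∈-++⁺ʳ; ∈-++⁻; ∈-filter⁺; ∈-filter⁻; ∈-map⁺; ∈-allFin)
open import Data.List.Properties
  using (map-++; map-cong; map-∘; length-map; length-tabulate; ∷-injective; ++-assoc; ++-identityʳ;
         filter-notAll; filter-all; filter-accept; filter-reject; filter-++)
open import Data.List.Relation.Binary.Subset.Propositional using (_⊆_)
open import Data.List.Relation.Unary.All using (all?)
import Data.List.Relation.Unary.All as All
open import Data.List.Relation.Unary.All.Properties using (¬All⇒Any¬; ¬Any⇒All¬)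
open import Data.List.Relation.Unary.AllPairs using ([]; _∷_)
open import Data.List.Relation.Unary.Any using (here; there)
import Data.List.Relation.Unary.Any as Any
open import Data.List.Relation.Unary.Any.Properties using (any⁺)
open import Data.List.Relation.Unary.Unique.Propositional using (Unique)
open import Data.List.Relation.Unary.Unique.Propositional.Properties using (allFin⁺; filter⁺)
open import Data.List.Relation.Unary.Unique.DecPropositional.Properties using (deduplicate-!)
open import Data.List.Reverse using (Reverse; []; _∶_∶ʳ_; reverseView)
open import Data.Nat
open import Data.Nat.DivMod using (_/_; _%_; m≡m%n+[m/n]*n; m%n<n; m/n*n≤m)
open import Data.Nat.Divisibility using (_∣_; divides)
open import Data.Nat.ListAction using (sum)
open import Data.Nat.ListAction.Properties using (sum-++)
open import Data.Nat.Logarithm using (⌊log₂_⌋; ⌊log₂⌋-mono-≤; ⌊log₂[2^n]⌋≡n)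
open import Data.Nat.Properties
open import Data.Nat.Tactic.RingSolver using (solve-∀)
open import Data.Product using (∃; _×_; _,_; proj₁; proj₂)
open import Data.Sum using (_⊎_; inj₁; inj₂)
open import Data.Unit using (tt)
open import Function using (_∘_; id)
open import Function.Bundles using (Equivalence)
open import Relation.Binary.Definitions using (DecidableEquality)
open import Relation.Binary.PropositionalEquality
open import Relation.Nullary using (¬_; Dec; yes; no; ¬?; does; contradiction)
open import Relation.Nullary.Decidable using (T?)

open CommutativeSemigroupProperties *-commutativeSemigroup
  using () renaming (interchange to *-interchange; x∙yz≈y∙xz to *-x∙yz≈y∙xz)
open CommutativeSemigroupProperties +-commutativeSemigroup
  using () renaming (interchange to +-interchange)

open ≤-Reasoning

private variable
  A I : Set

*-cancelʳ-≤′ : ∀ m n o → 0 < o → m * o ≤ n * o → m ≤ n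
*-cancelʳ-≤′ m n o o>0 = *-cancelʳ-≤ m n o {{>-nonZero o>0}}

^-distribʳ-* : ∀ m n o → (m * n) ^ o ≡ m ^ o * n ^ o
^-distribʳ-* m n zero    = refl
^-distribʳ-* m n (suc o) = begin-equality
  m * n * (m * n) ^ o      ≡⟨ cong (m * n *_) (^-distribʳ-* m n o) ⟩
  m * n * (m ^ o * n ^ o)  ≡⟨ *-interchange m n (m ^ o) (n ^ o) ⟩
  m ^ suc o * n ^ suc o    ∎

*-^-mono-≤ : ∀ {a x b y} c → a * x ≤ b * y → a ^ c * x ^ c ≤ b ^ c * y ^ c
*-^-mono-≤ {a} {x} {b} {y} c ax≤by = begin
  a ^ c * x ^ c  ≡⟨ ^-distribʳ-* a x c ⟨
  (a * x) ^ c    ≤⟨ ^-monoˡ-≤ c ax≤by ⟩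
  (b * y) ^ c    ≡⟨ ^-distribʳ-* b y c ⟩
  b ^ c * y ^ c  ∎

m<[1+m/n]*n : ∀ m n .{{_ : NonZero n}} → m < suc (m / n) * n
m<[1+m/n]*n m n = begin-strict
  m                      ≡⟨ m≡m%n+[m/n]*n m n ⟩
  m % n + m / n * n      <⟨ +-monoˡ-< (m / n * n) (m%n<n m n) ⟩
  n + m / n * n          ∎

m*n≤o⇒m≤o/n : ∀ m n o .{{_ : NonZero n}} → m * n ≤ o → m ≤ o / n
m*n≤o⇒m≤o/n m n o mn≤o = ≤-pred (*-cancelʳ-< n m (suc (o / n)) (≤-<-trans mn≤o (m<[1+m/n]*n o n)))

m*[1+n/m]≤n+m : ∀ m n .{{_ : NonZero m}} → m * suc (n / m) ≤ n + m
m*[1+n/m]≤n+m m n = begin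
  m * suc (n / m)    ≡⟨ *-suc m (n / m) ⟩
  m + m * (n / m)    ≡⟨ cong (m +_) (*-comm m (n / m)) ⟩
  m + n / m * m      ≤⟨ +-monoʳ-≤ m (m/n*n≤m n m) ⟩
  m + n              ≡⟨ +-comm m n ⟩
  n + m              ∎

m≤4*[m/2] : ∀ m → 2 ≤ m → m ≤ 4 * (m / 2)
m≤4*[m/2] m 2≤m = +-cancelʳ-≤ m m (4 * h) (begin
  m + m                        ≤⟨ +-mono-≤ m≤2h+1 m≤2h+1 ⟩
  (2 * h + 1) + (2 * h + 1)    ≡⟨ double h ⟩
  4 * h + 2                    ≤⟨ +-monoʳ-≤ (4 * h) 2≤m ⟩
  4 * h + m                    ∎)
  where
  h = m / 2
  halve : ∀ h → suc h * 2 ≡ suc (2 * h + 1)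
  halve = solve-∀
  double : ∀ h → (2 * h + 1) + (2 * h + 1) ≡ 4 * h + 2
  double = solve-∀
  m≤2h+1 : m ≤ 2 * h + 1
  m≤2h+1 = ≤-pred (subst (m <_) (halve h) (m<[1+m/n]*n m 2))

-- Ratios with cleared denominators: for y ≤ z, (y/z) ^ t ≤ (y/z) ^ s when s ≤ t.
^-cross-≤ : ∀ {y z s t} → y ≤ z → s ≤ t → z ^ s * y ^ t ≤ z ^ t * y ^ s
^-cross-≤ {y} {z} {t = t} y≤z z≤n = begin
  1 * y ^ t  ≡⟨ *-comm 1 (y ^ t) ⟩
  y ^ t * 1  ≤⟨ *-monoˡ-≤ 1 (^-monoˡ-≤ t y≤z) ⟩
  z ^ t * 1  ∎
^-cross-≤ {y} {z} {suc s} {suc t} y≤z (s≤s s≤t) = begin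
  z * z ^ s * (y * y ^ t)    ≡⟨ *-interchange z (z ^ s) y (y ^ t) ⟩
  z * y * (z ^ s * y ^ t)    ≤⟨ *-monoʳ-≤ (z * y) (^-cross-≤ y≤z s≤t) ⟩
  z * y * (z ^ t * y ^ s)    ≡⟨ *-interchange z y (z ^ t) (y ^ s) ⟩
  z * z ^ t * (y * y ^ s)    ∎

^-block-upper : ∀ {y z} a b n s c → y ≤ z → 0 < y → z ^ n * a ≤ y ^ n * b → s ≤ n * c →
                z ^ s * a ^ c ≤ y ^ s * b ^ c
^-block-upper {y} {z} a b n s c y≤z y>0 base s≤nc =
  *-cancelʳ-≤′ _ _ (y ^ (n * c)) (m^n>0 y {{>-nonZero y>0}} (n * c)) (begin
    z ^ s * a ^ c * y ^ (n * c)      ≡⟨ swap (z ^ s) (a ^ c) _ ⟩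
    z ^ s * y ^ (n * c) * a ^ c      ≤⟨ *-monoˡ-≤ (a ^ c) (^-cross-≤ y≤z s≤nc) ⟩
    z ^ (n * c) * y ^ s * a ^ c      ≡⟨ cong (λ v → v * y ^ s * a ^ c) (^-*-assoc z n c) ⟨
    (z ^ n) ^ c * y ^ s * a ^ c      ≡⟨ swap ((z ^ n) ^ c) (y ^ s) (a ^ c) ⟩
    (z ^ n) ^ c * a ^ c * y ^ s      ≤⟨ *-monoˡ-≤ (y ^ s) (*-^-mono-≤ c base) ⟩
    (y ^ n) ^ c * b ^ c * y ^ s      ≡⟨ cong (λ v → v * b ^ c * y ^ s) (^-*-assoc y n c) ⟩
    y ^ (n * c) * b ^ c * y ^ s      ≡⟨ rotate (y ^ (n * c)) (b ^ c) (y ^ s) ⟩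
    y ^ s * b ^ c * y ^ (n * c)      ∎)
  where
  swap : ∀ u v w → u * v * w ≡ u * w * v
  swap = solve-∀
  rotate : ∀ u v w → u * v * w ≡ w * v * u
  rotate = solve-∀

^-block-lower : ∀ {y z} b n t D → y ≤ z → 0 < y → y ^ n * b ≤ z ^ n → n * t ≤ D →
                y ^ D * b ^ t ≤ z ^ D
^-block-lower {y} {z} b n t D y≤z y>0 base nt≤D =
  *-cancelʳ-≤′ _ _ (y ^ (n * t)) (m^n>0 y {{>-nonZero y>0}} (n * t)) (begin
    y ^ D * b ^ t * y ^ (n * t)      ≡⟨ rotate (y ^ D) (b ^ t) _ ⟩
    y ^ (n * t) * b ^ t * y ^ D      ≡⟨ cong (λ v → v * b ^ t * y ^ D) (^-*-assoc y n t) ⟨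
    (y ^ n) ^ t * b ^ t * y ^ D      ≤⟨ *-monoˡ-≤ (y ^ D) (^-block base) ⟩
    (z ^ n) ^ t * y ^ D              ≡⟨ cong (_* y ^ D) (^-*-assoc z n t) ⟩
    z ^ (n * t) * y ^ D              ≤⟨ ^-cross-≤ y≤z nt≤D ⟩
    z ^ D * y ^ (n * t)              ∎)
  where
  rotate : ∀ u v w → u * v * w ≡ w * v * u
  rotate = solve-∀
  ^-block : y ^ n * b ≤ z ^ n → (y ^ n) ^ t * b ^ t ≤ (z ^ n) ^ t
  ^-block le = begin
    (y ^ n) ^ t * b ^ t  ≡⟨ ^-distribʳ-* (y ^ n) b t ⟨
    (y ^ n * b) ^ t      ≤⟨ ^-monoˡ-≤ t le ⟩
    (z ^ n) ^ t          ∎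

bernoulli : ∀ Q n → Q ^ n * (Q + n) ≤ suc Q ^ n * Q
bernoulli Q zero = ≤-reflexive (cong (1 *_) (+-identityʳ Q))
bernoulli Q (suc n) = begin
  Q ^ suc n * (Q + suc n)               ≤⟨ m≤m+n _ (Q ^ n * n) ⟩
  Q ^ suc n * (Q + suc n) + Q ^ n * n   ≡⟨ step Q (Q ^ n) n ⟩
  Q ^ n * (Q + n) * suc Q               ≤⟨ *-monoˡ-≤ (suc Q) (bernoulli Q n) ⟩
  suc Q ^ n * Q * suc Q                 ≡⟨ swap (suc Q ^ n) Q (suc Q) ⟩
  suc Q ^ suc n * Q                     ∎
  where
  step : ∀ Q P n → Q * P * (Q + suc n) + P * n ≡ P * (Q + n) * suc Q
  step = solve-∀
  swap : ∀ u v w → u * v * w ≡ w * u * v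
  swap = solve-∀

bernoulli-upper : ∀ n x → suc (n + x) ^ n * x ≤ (n + x) ^ suc n
bernoulli-upper zero x = ≤-reflexive (*-comm 1 x)
bernoulli-upper (suc n) x = begin
  B ^ suc n * x             ≡⟨ *-assoc B (B ^ n) x ⟩
  B * (B ^ n * x)           ≡⟨ *-x∙yz≈y∙xz B (B ^ n) x ⟩
  B ^ n * (B * x)           ≤⟨ *-monoʳ-≤ (B ^ n) (m≤m+n (B * x) (suc n)) ⟩
  B ^ n * (B * x + suc n)   ≡⟨ cong (B ^ n *_) (split n x) ⟩
  B ^ n * (suc x * m)       ≡⟨ *-assoc (B ^ n) (suc x) m ⟨
  B ^ n * suc x * m         ≤⟨ *-monoˡ-≤ m shifted ⟩
  m ^ suc n * m             ≡⟨ *-comm (m ^ suc n) m ⟩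
  m ^ suc (suc n)           ∎
  where
  m = suc (n + x)
  B = suc m
  split : ∀ n x → suc (suc (n + x)) * x + suc n ≡ suc x * suc (n + x)
  split = solve-∀
  shifted : B ^ n * suc x ≤ m ^ suc n
  shifted = subst (λ v → suc v ^ n * suc x ≤ v ^ suc n) (+-suc n x) (bernoulli-upper n (suc x))

bernoulli-doubling : ∀ Q → 0 < Q → Q ^ Q * 2 ≤ suc Q ^ Q
bernoulli-doubling Q Q>0 = *-cancelʳ-≤′ _ _ Q Q>0 (begin
  Q ^ Q * 2 * Q      ≡⟨ twice (Q ^ Q) Q ⟩
  Q ^ Q * (Q + Q)    ≤⟨ bernoulli Q Q ⟩
  suc Q ^ Q * Q      ∎)
  where
  twice : ∀ u v → u * 2 * v ≡ u * (v + v)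
  twice = solve-∀

bernoulli-halving : ∀ W b → 2 * b ≤ suc W → suc W ^ b ≤ W ^ b * 2
bernoulli-halving W zero _ = s≤s z≤n
bernoulli-halving W (suc b) 2b≤1+W
  with m≤n⇒∃[o]m+o≡n (subst (λ v → b + suc v ≤ W) (+-identityʳ b) (≤-pred 2b≤1+W))
... | y , refl = *-cancelʳ-≤′ _ _ x (s≤s z≤n) (begin
  suc W ^ suc b * x         ≡⟨ *-assoc (suc W) (suc W ^ b) x ⟩
  suc W * (suc W ^ b * x)   ≤⟨ *-monoʳ-≤ (suc W) upper ⟩
  suc W * W ^ suc b         ≤⟨ *-monoˡ-≤ (W ^ suc b) (m≤m+n (suc W) y) ⟩
  (suc W + y) * W ^ suc b   ≡⟨ double b y (W ^ suc b) ⟩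
  W ^ suc b * 2 * x         ∎)
  where
  x = suc b + y
  upper : suc W ^ b * x ≤ W ^ suc b
  upper = subst (λ v → suc v ^ b * x ≤ v ^ suc b) (sym (+-assoc b (suc b) y)) (bernoulli-upper b x)
  double : ∀ b y P → (suc (b + suc b + y) + y) * P ≡ P * 2 * (suc b + y)
  double = solve-∀

compound-≤ : ∀ q r → 0 < q → suc (q * suc r) ^ q * r ≤ (q * suc r) ^ q * suc r
compound-≤ q r q>0 = *-cancelʳ-≤′ _ _ q q>0 (begin
  suc Y ^ q * r * q         ≡⟨ *-assoc (suc Y ^ q) r q ⟩
  suc Y ^ q * (r * q)       ≡⟨ cong (suc Y ^ q *_) (*-comm r q) ⟩
  suc Y ^ q * (q * r)       ≤⟨ upper ⟩
  Y * Y ^ q                 ≡⟨ rearrange q r (Y ^ q) ⟩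
  Y ^ q * suc r * q         ∎)
  where
  Y = q * suc r
  upper : suc Y ^ q * (q * r) ≤ Y ^ suc q
  upper = subst (λ v → suc v ^ q * (q * r) ≤ v ^ suc q) (sym (*-suc q r)) (bernoulli-upper q (q * r))
  rearrange : ∀ q r P → q * suc r * P ≡ P * suc r * q
  rearrange = solve-∀

-- Q = r + 1 is the base of the exponential moment (1 + 1/Q) ^ load; the factors 2 ^ u and 2 ^ t
-- absorb (Q² / (Q² − 1)) ^ c and ((Q + 1) / Q) ^ D respectively.
record TailParameters (c D E : ℕ) : Set where
  field
    r t u b : ℕ
    r>0     : 0 < r
    Qt≤D    : suc r * t ≤ D
    2b≤Q²   : 2 * b ≤ suc r * suc r
    c≤bu    : c ≤ b * u
    E+u≤t   : E + u ≤ t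

module _ {c D E : ℕ} (P : TailParameters c D E) where
  open TailParameters P

  tail-arithmetic : ∀ q s K → 0 < q → s ≤ q * c → K ≤ 2 ^ E →
    suc (q * suc r) ^ s * suc r ^ (c + D) * K ≤ suc (suc r) ^ (c + D) * (q * suc r) ^ s
  tail-arithmetic q s K q>0 s≤qc K≤2^E =
    *-cancelʳ-≤′ _ _ (R * Tᵤ) (*-mono-≤ (m^n>0 r {{>-nonZero r>0}} c) (m^n>0 2 u)) (begin
      suc Y ^ s * Q ^ (c + D) * K * (R * Tᵤ)
        ≡⟨ regroup₁ (suc Y ^ s) (Q ^ (c + D)) K R Tᵤ ⟩
      suc Y ^ s * R * Q ^ (c + D) * (K * Tᵤ)
        ≤⟨ *-mono-≤ (*-monoˡ-≤ (Q ^ (c + D)) compound) K*2^u≤2^t ⟩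
      Y ^ s * Q ^ c * Q ^ (c + D) * 2 ^ t
        ≡⟨ cong (λ v → Y ^ s * Q ^ c * v * 2 ^ t) (^-distribˡ-+-* Q c D) ⟩
      Y ^ s * Q ^ c * (Q ^ c * Q ^ D) * 2 ^ t
        ≡⟨ regroup₂ (Y ^ s) (Q ^ c) (Q ^ D) (2 ^ t) ⟩
      Y ^ s * (Q ^ c * Q ^ c) * (Q ^ D * 2 ^ t)
        ≡⟨ cong (λ v → Y ^ s * v * (Q ^ D * 2 ^ t)) Q^c*Q^c≡ ⟩
      Y ^ s * suc W ^ c * (Q ^ D * 2 ^ t)
        ≤⟨ *-mono-≤ (*-monoʳ-≤ (Y ^ s) halving) doubling ⟩
      Y ^ s * (W ^ c * Tᵤ) * suc Q ^ D
        ≡⟨ cong (λ v → Y ^ s * (v * Tᵤ) * suc Q ^ D) (^-distribʳ-* r (suc Q) c) ⟩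
      Y ^ s * (R * suc Q ^ c * Tᵤ) * suc Q ^ D
        ≡⟨ regroup₃ (Y ^ s) R (suc Q ^ c) Tᵤ (suc Q ^ D) ⟩
      suc Q ^ c * suc Q ^ D * Y ^ s * (R * Tᵤ)
        ≡⟨ cong (λ v → v * Y ^ s * (R * Tᵤ)) (^-distribˡ-+-* (suc Q) c D) ⟨
      suc Q ^ (c + D) * Y ^ s * (R * Tᵤ) ∎)
    where
    Q = suc r
    Y = q * Q
    W = r * suc Q
    R = r ^ c
    Tᵤ = 2 ^ u
    1+W≡Q*Q : suc W ≡ Q * Q
    1+W≡Q*Q = square r
      where square : ∀ r → suc (r * suc (suc r)) ≡ suc r * suc r
            square = solve-∀
    Q^c*Q^c≡ : Q ^ c * Q ^ c ≡ suc W ^ c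
    Q^c*Q^c≡ = trans (sym (^-distribʳ-* Q Q c)) (cong (_^ c) (sym 1+W≡Q*Q))
    compound : suc Y ^ s * R ≤ Y ^ s * Q ^ c
    compound = ^-block-upper r Q q s c (n≤1+n Y) (*-mono-≤ q>0 (s≤s z≤n)) (compound-≤ q r q>0) s≤qc
    halving : suc W ^ c ≤ W ^ c * Tᵤ
    halving = begin
      suc W ^ c            ≡⟨ *-identityʳ (suc W ^ c) ⟨
      suc W ^ c * 1        ≡⟨ cong (suc W ^ c *_) (^-zeroˡ u) ⟨
      suc W ^ c * 1 ^ u    ≤⟨ ^-block-upper 1 2 b c u (n≤1+n W) (*-mono-≤ r>0 (s≤s z≤n)) base c≤bu ⟩
      W ^ c * Tᵤ            ∎
      where
      base : suc W ^ b * 1 ≤ W ^ b * 2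
      base = ≤-trans (≤-reflexive (*-identityʳ _))
               (bernoulli-halving W b (subst (2 * b ≤_) (sym 1+W≡Q*Q) 2b≤Q²))
    doubling : Q ^ D * 2 ^ t ≤ suc Q ^ D
    doubling = ^-block-lower 2 Q t D (n≤1+n Q) (s≤s z≤n) (bernoulli-doubling Q (s≤s z≤n)) Qt≤D
    K*2^u≤2^t : K * Tᵤ ≤ 2 ^ t
    K*2^u≤2^t = begin
      K * 2 ^ u      ≤⟨ *-monoˡ-≤ (2 ^ u) K≤2^E ⟩
      2 ^ E * 2 ^ u  ≡⟨ ^-distribˡ-+-* 2 E u ⟨
      2 ^ (E + u)    ≤⟨ ^-monoʳ-≤ 2 E+u≤t ⟩
      2 ^ t          ∎
    regroup₁ : ∀ a b k x y → a * b * k * (x * y) ≡ a * x * b * (k * y)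
    regroup₁ = solve-∀
    regroup₂ : ∀ a b c d → a * b * (b * c) * d ≡ a * (b * b) * (c * d)
    regroup₂ = solve-∀
    regroup₃ : ∀ a b c d e → a * (b * c * d) * e ≡ c * e * a * (b * d)
    regroup₃ = solve-∀

-- Q = ⌊16c/D⌋ + 2 gives Q (E + u) ≤ D, since 4Q⌊c/b⌋ ≤ D as Q D ≥ 16c,
-- and 4Q(E + 1) ≤ 3D as Q D ≤ 16c + 2D.
tail-parameters : ∀ c D E → 8 * suc E ≤ D → 32 * c * suc E ≤ D * D → TailParameters c D E
tail-parameters c zero E () _
tail-parameters c D@(suc _) E 8[1+E]≤D 32c[1+E]≤D² = record
  { r = suc (16 * c / D) ; t = D / Q ; u = suc (c / b) ; b = b
  ; r>0 = s≤s z≤n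
  ; Qt≤D = subst (_≤ D) (*-comm (D / Q) Q) (m/n*n≤m D Q)
  ; 2b≤Q² = subst (_≤ Q * Q) (*-comm b 2) (m/n*n≤m (Q * Q) 2)
  ; c≤bu = subst (c ≤_) (*-comm (suc (c / b)) b) (<⇒≤ (m<[1+m/n]*n c b))
  ; E+u≤t = m*n≤o⇒m≤o/n (E + suc (c / b)) Q D (subst (_≤ D) (*-comm Q (E + suc (c / b))) Q[E+u]≤D)
  }
  where
  Q = suc (suc (16 * c / D))
  b = Q * Q / 2

  4≤Q² : 4 ≤ Q * Q
  4≤Q² = *-mono-≤ {2} {Q} (s≤s (s≤s z≤n)) (s≤s (s≤s z≤n))

  Q²≤4b : Q * Q ≤ 4 * b
  Q²≤4b = m≤4*[m/2] (Q * Q) (≤-trans (s≤s (s≤s z≤n)) 4≤Q²)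

  instance
    b-nonZero : NonZero b
    b-nonZero = >-nonZero (*-cancelˡ-< 4 0 b (≤-trans (s≤s z≤n) (≤-trans 4≤Q² Q²≤4b)))

  16c≤QD : 16 * c ≤ Q * D
  16c≤QD = ≤-trans (<⇒≤ (m<[1+m/n]*n (16 * c) D)) (*-monoˡ-≤ D (n≤1+n (suc (16 * c / D))))

  QD≤16c+2D : Q * D ≤ 16 * c + 2 * D
  QD≤16c+2D = ≤-trans (≤-reflexive (unfold (16 * c / D) D)) (+-monoˡ-≤ (2 * D) (m/n*n≤m (16 * c) D))
    where unfold : ∀ x D → suc (suc x) * D ≡ x * D + 2 * D
          unfold = solve-∀

  4Q[c/b]≤D : 4 * Q * (c / b) ≤ D
  4Q[c/b]≤D = *-cancelʳ-≤′ _ _ Q (s≤s z≤n) (begin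
    4 * Q * (c / b) * Q         ≡⟨ regroup Q (c / b) ⟩
    4 * (c / b) * (Q * Q)       ≤⟨ *-monoʳ-≤ (4 * (c / b)) Q²≤4b ⟩
    4 * (c / b) * (4 * b)       ≡⟨ regroup′ (c / b) b ⟩
    16 * (c / b * b)            ≤⟨ *-monoʳ-≤ 16 (m/n*n≤m c b) ⟩
    16 * c                      ≤⟨ 16c≤QD ⟩
    Q * D                       ≡⟨ *-comm Q D ⟩
    D * Q                       ∎)
    where
    regroup : ∀ Q a → 4 * Q * a * Q ≡ 4 * a * (Q * Q)
    regroup = solve-∀
    regroup′ : ∀ a b → 4 * a * (4 * b) ≡ 16 * (a * b)
    regroup′ = solve-∀

  4Q[1+E]≤3D : 4 * Q * suc E ≤ 3 * D
  4Q[1+E]≤3D = *-cancelʳ-≤′ _ _ D (s≤s z≤n) (begin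
    4 * Q * suc E * D                         ≡⟨ regroup Q (suc E) D ⟩
    4 * suc E * (Q * D)                       ≤⟨ *-monoʳ-≤ (4 * suc E) QD≤16c+2D ⟩
    4 * suc E * (16 * c + 2 * D)              ≡⟨ expand (suc E) c D ⟩
    2 * (32 * c * suc E) + 8 * suc E * D      ≤⟨ +-mono-≤ (*-monoʳ-≤ 2 32c[1+E]≤D²) (*-monoˡ-≤ D 8[1+E]≤D) ⟩
    2 * (D * D) + D * D                       ≡⟨ collect D ⟩
    3 * D * D                                 ∎)
    where
    regroup : ∀ Q a D → 4 * Q * a * D ≡ 4 * a * (Q * D)
    regroup = solve-∀
    expand : ∀ a c D → 4 * a * (16 * c + 2 * D) ≡ 2 * (32 * c * a) + 8 * a * D
    expand = solve-∀
    collect : ∀ D → 2 * (D * D) + D * D ≡ 3 * D * D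
    collect = solve-∀

  Q[E+u]≤D : Q * (E + suc (c / b)) ≤ D
  Q[E+u]≤D = *-cancelˡ-≤ 4 (begin
    4 * (Q * (E + suc (c / b)))          ≡⟨ expand Q E (c / b) ⟩
    4 * Q * suc E + 4 * Q * (c / b)      ≤⟨ +-mono-≤ 4Q[1+E]≤3D 4Q[c/b]≤D ⟩
    3 * D + D                            ≡⟨ collect D ⟩
    4 * D                                ∎)
    where
    expand : ∀ Q E a → 4 * (Q * (E + suc a)) ≡ 4 * Q * suc E + 4 * Q * a
    expand = solve-∀
    collect : ∀ D → 3 * D + D ≡ 4 * D
    collect = solve-∀

-- Bucket headroom

m*m≤n*n⇒m≤n : ∀ {m n} → m * m ≤ n * n → m ≤ n
m*m≤n*n⇒m≤n {m} {n} m²≤n² with m ≤? n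
... | yes m≤n = m≤n
... | no m≰n = contradiction m²≤n² (<⇒≱ (*-mono-< (≰⇒> m≰n) (≰⇒> m≰n)))

balanced-share : ∀ {α c D V} → 1 ≤ V → 129 * V ≤ α → c + c ≤ α + 3 → c + D ≡ suc α →
                 8 * V ≤ D × 32 * c * V ≤ D * D
balanced-share {zero} {V = V} 1≤V 129V≤α _ _ =
  contradiction (≤-trans (*-monoʳ-≤ 129 1≤V) 129V≤α) λ ()
balanced-share {suc y} {c} {D} {V} 1≤V 129V≤α 2c≤α+3 c+D≡1+α = 8V≤D , 32cV≤D²
  where
  α = suc y
  α≤2D+1 : α ≤ 2 * D + 1
  α≤2D+1 = +-cancelʳ-≤ (c + c) α (2 * D + 1) (begin
    α + (c + c)            ≤⟨ +-monoʳ-≤ α 2c≤α+3 ⟩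
    α + (α + 3)            ≡⟨ collect α ⟩
    2 * suc α + 1          ≡⟨ cong (λ v → 2 * v + 1) c+D≡1+α ⟨
    2 * (c + D) + 1        ≡⟨ distribute c D ⟩
    (2 * D + 1) + (c + c)  ∎)
    where
    collect : ∀ α → α + (α + 3) ≡ 2 * suc α + 1
    collect = solve-∀
    distribute : ∀ c D → 2 * (c + D) + 1 ≡ (2 * D + 1) + (c + c)
    distribute = solve-∀
  128V≤y : 128 * V ≤ y
  128V≤y = ≤-pred (begin
    suc (128 * V)   ≡⟨ +-comm 1 (128 * V) ⟩
    128 * V + 1     ≤⟨ +-monoʳ-≤ (128 * V) 1≤V ⟩
    128 * V + V     ≡⟨ collect V ⟩
    129 * V         ≤⟨ 129V≤α ⟩
    α               ∎)
    where collect : ∀ V → 128 * V + V ≡ 129 * V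
          collect = solve-∀
  y≤2D : y ≤ 2 * D
  y≤2D = ≤-pred (subst (α ≤_) (+-comm (2 * D) 1) α≤2D+1)
  8V≤D : 8 * V ≤ D
  8V≤D = *-cancelˡ-≤ 2 (begin
    2 * (8 * V)   ≡⟨ *-assoc 2 8 V ⟨
    16 * V        ≤⟨ *-monoˡ-≤ V (m≤m+n 16 112) ⟩
    128 * V       ≤⟨ 128V≤y ⟩
    y             ≤⟨ y≤2D ⟩
    2 * D         ∎)
  32cV≤D² : 32 * c * V ≤ D * D
  32cV≤D² = *-cancelˡ-≤ 4 (begin
    4 * (32 * c * V)       ≡⟨ regroup₁ c V ⟩
    64 * (c + c) * V       ≤⟨ *-monoˡ-≤ V (*-monoʳ-≤ 64 (subst (c + c ≤_) (sym (+-suc y 3)) 2c≤α+3)) ⟩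
    64 * (y + 4) * V       ≤⟨ *-monoˡ-≤ V (*-monoʳ-≤ 64 (+-monoʳ-≤ y 4≤y)) ⟩
    64 * (y + y) * V       ≡⟨ regroup₂ y V ⟩
    y * (128 * V)          ≤⟨ *-monoʳ-≤ y 128V≤y ⟩
    y * y                  ≤⟨ *-mono-≤ y≤2D y≤2D ⟩
    2 * D * (2 * D)        ≡⟨ regroup₃ D ⟩
    4 * (D * D)            ∎)
    where
    4≤y : 4 ≤ y
    4≤y = ≤-trans (≤-trans (m≤m+n 4 124) (*-monoʳ-≤ 128 1≤V)) 128V≤y
    regroup₁ : ∀ c V → 4 * (32 * c * V) ≡ 64 * (c + c) * V
    regroup₁ = solve-∀
    regroup₂ : ∀ y V → 64 * (y + y) * V ≡ y * (128 * V)
    regroup₂ = solve-∀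
    regroup₃ : ∀ D → 2 * D * (2 * D) ≡ 4 * (D * D)
    regroup₃ = solve-∀

heavy-share : ∀ {q α k' c D W L} → 0 < q → 1 ≤ W → 1 ≤ α → L ≤ α →
              q * α < 2 * k' → q * c ≤ 2 * k' →
              128 * W * (128 * W) * (k' * k') * L ≤ q * D * (q * D) * α →
              8 * (W * L) ≤ D × 32 * c * (W * L) ≤ D * D
heavy-share {q} {α} {k'} {c} {D} {W} {L} q>0 1≤W 1≤α L≤α qα<2k' qc≤2k' hyp = 8V≤D , 32cV≤D²
  where
  C² = 128 * W * (128 * W)
  k'>0 : 0 < k'
  k'>0 = *-cancelˡ-< 2 0 k' (≤-trans (s≤s z≤n) qα<2k')
  128W≤C² : 128 * W ≤ C²
  128W≤C² = ≤-trans (≤-reflexive (sym (*-identityʳ (128 * W)))) (*-monoʳ-≤ (128 * W) (≤-trans 1≤W (m≤n*m W 128)))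
  C²k'L≤2qD² : C² * k' * L ≤ 2 * q * (D * D)
  C²k'L≤2qD² = *-cancelʳ-≤′ _ _ k' k'>0 (begin
    C² * k' * L * k'             ≡⟨ regroup₁ C² k' L ⟩
    C² * (k' * k') * L           ≤⟨ hyp ⟩
    q * D * (q * D) * α          ≡⟨ regroup₂ q D α ⟩
    q * (D * D) * (q * α)        ≤⟨ *-monoʳ-≤ (q * (D * D)) (<⇒≤ qα<2k') ⟩
    q * (D * D) * (2 * k')       ≡⟨ regroup₃ q (D * D) k' ⟩
    2 * q * (D * D) * k'         ∎)
    where
    regroup₁ : ∀ C k L → C * k * L * k ≡ C * (k * k) * L
    regroup₁ = solve-∀
    regroup₂ : ∀ q D α → q * D * (q * D) * α ≡ q * (D * D) * (q * α)
    regroup₂ = solve-∀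
    regroup₃ : ∀ q E k → q * E * (2 * k) ≡ 2 * q * E * k
    regroup₃ = solve-∀
  32cV≤D² : 32 * c * (W * L) ≤ D * D
  32cV≤D² = *-cancelˡ-≤ (2 * q) {{>-nonZero (*-mono-≤ (s≤s (z≤n {1})) q>0)}} (begin
    2 * q * (32 * c * (W * L))   ≡⟨ regroup₁ q c W L ⟩
    64 * (W * L) * (q * c)       ≤⟨ *-monoʳ-≤ (64 * (W * L)) qc≤2k' ⟩
    64 * (W * L) * (2 * k')      ≡⟨ regroup₂ W L k' ⟩
    128 * W * k' * L             ≤⟨ *-monoˡ-≤ L (*-monoˡ-≤ k' 128W≤C²) ⟩
    C² * k' * L                  ≤⟨ C²k'L≤2qD² ⟩
    2 * q * (D * D)              ∎)
    where
    regroup₁ : ∀ q c W L → 2 * q * (32 * c * (W * L)) ≡ 64 * (W * L) * (q * c)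
    regroup₁ = solve-∀
    regroup₂ : ∀ W L k → 64 * (W * L) * (2 * k) ≡ 128 * W * k * L
    regroup₂ = solve-∀
  C²αL≤4D² : C² * α * L ≤ 4 * (D * D)
  C²αL≤4D² = *-cancelʳ-≤′ _ _ (q * q * α) (*-mono-≤ (*-mono-≤ q>0 q>0) 1≤α) (begin
    C² * α * L * (q * q * α)           ≡⟨ regroup₁ C² α L q ⟩
    C² * (q * α * (q * α)) * L         ≤⟨ *-monoˡ-≤ L (*-monoʳ-≤ C² (*-mono-≤ (<⇒≤ qα<2k') (<⇒≤ qα<2k'))) ⟩
    C² * (2 * k' * (2 * k')) * L       ≡⟨ regroup₂ C² k' L ⟩
    4 * (C² * (k' * k') * L)           ≤⟨ *-monoʳ-≤ 4 hyp ⟩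
    4 * (q * D * (q * D) * α)          ≡⟨ regroup₃ q D α ⟩
    4 * (D * D) * (q * q * α)          ∎)
    where
    regroup₁ : ∀ C α L q → C * α * L * (q * q * α) ≡ C * (q * α * (q * α)) * L
    regroup₁ = solve-∀
    regroup₂ : ∀ C k L → C * (2 * k * (2 * k)) * L ≡ 4 * (C * (k * k) * L)
    regroup₂ = solve-∀
    regroup₃ : ∀ q D α → 4 * (q * D * (q * D) * α) ≡ 4 * (D * D) * (q * q * α)
    regroup₃ = solve-∀
  128WL≤2D : 128 * W * L ≤ 2 * D
  128WL≤2D = m*m≤n*n⇒m≤n (begin
    128 * W * L * (128 * W * L)   ≡⟨ regroup₁ W L ⟩
    C² * L * L                    ≤⟨ *-monoˡ-≤ L (*-monoʳ-≤ C² L≤α) ⟩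
    C² * α * L                    ≤⟨ C²αL≤4D² ⟩
    4 * (D * D)                   ≡⟨ regroup₂ D ⟩
    2 * D * (2 * D)               ∎)
    where
    regroup₁ : ∀ W L → 128 * W * L * (128 * W * L) ≡ 128 * W * (128 * W) * L * L
    regroup₁ = solve-∀
    regroup₂ : ∀ D → 4 * (D * D) ≡ 2 * D * (2 * D)
    regroup₂ = solve-∀
  8V≤D : 8 * (W * L) ≤ D
  8V≤D = *-cancelˡ-≤ 2 (begin
    2 * (8 * (W * L))   ≡⟨ regroup W L ⟩
    16 * W * L          ≤⟨ *-monoˡ-≤ L (*-monoˡ-≤ W (m≤m+n 16 112)) ⟩
    128 * W * L         ≤⟨ 128WL≤2D ⟩
    2 * D               ∎)
    where
    regroup : ∀ W L → 2 * (8 * (W * L)) ≡ 16 * W * L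
    regroup = solve-∀

record Headroom (α c V : ℕ) : Set where
  field
    D        : ℕ
    c+D≡1+α  : c + D ≡ suc α
    8V≤D     : 8 * V ≤ D
    32cV≤D²  : 32 * c * V ≤ D * D

share-headroom : ∀ {q α k' g W L} .{{_ : NonZero q}} → 2 ≤ q → 1 ≤ W → 1 ≤ L →
                 129 * (W * L) ≤ α → k' + g ≡ q * α →
                 128 * W * (128 * W) * (k' * k') * L ≤ g * g * α →
                 Headroom α (suc ((suc α ⊔ k') / q)) (W * L)
share-headroom {q} {α} {k'} {g} {W} {L} 2≤q 1≤W 1≤L 129V≤α k'+g≡qα hyp = headroom (2 * k' ≤? q * α)
  where
  V = W * L
  a = suc α ⊔ k'
  c = suc (a / q)
  1≤V : 1 ≤ V
  1≤V = *-mono-≤ 1≤W 1≤L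
  129≤α : 129 ≤ α
  129≤α = ≤-trans (*-monoʳ-≤ 129 1≤V) 129V≤α
  2≤α : 2 ≤ α
  2≤α = ≤-trans (m≤m+n 2 127) 129≤α
  L≤α : L ≤ α
  L≤α = ≤-trans (≤-trans (≤-trans (≤-reflexive (sym (*-identityˡ L))) (*-monoˡ-≤ L 1≤W)) (m≤n*m V 129)) 129V≤α
  qc≤a+q : q * c ≤ a + q
  qc≤a+q = m*[1+n/m]≤n+m q a
  a≤qα : a ≤ q * α
  a≤qα = ⊔-lub 1+α≤qα (≤-trans (m≤m+n k' g) (≤-reflexive k'+g≡qα))
    where
    1+α≤qα : suc α ≤ q * α
    1+α≤qα = begin
      1 + α        ≤⟨ +-monoˡ-≤ α (≤-trans (s≤s z≤n) 2≤α) ⟩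
      α + α        ≡⟨ cong (α +_) (+-identityʳ α) ⟨
      2 * α        ≤⟨ *-monoˡ-≤ α 2≤q ⟩
      q * α        ∎
  c≤1+α : c ≤ suc α
  c≤1+α = *-cancelˡ-≤ q (begin
    q * c          ≤⟨ qc≤a+q ⟩
    a + q          ≤⟨ +-monoˡ-≤ q a≤qα ⟩
    q * α + q      ≡⟨ +-comm (q * α) q ⟩
    q + q * α      ≡⟨ *-suc q α ⟨
    q * suc α      ∎)
  D = suc α ∸ c
  c+D≡1+α : c + D ≡ suc α
  c+D≡1+α = m+[n∸m]≡n c≤1+α

  headroom : Dec (2 * k' ≤ q * α) → Headroom α c V
  headroom (yes 2k'≤qα) = record
    { D = D ; c+D≡1+α = c+D≡1+α ; 8V≤D = proj₁ shares ; 32cV≤D² = proj₂ shares }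
    where
    2a≤q[1+α] : 2 * a ≤ q * suc α
    2a≤q[1+α] = subst (_≤ q * suc α) (sym (*-distribˡ-⊔ 2 (suc α) k'))
      (⊔-lub (*-monoˡ-≤ (suc α) 2≤q) (≤-trans 2k'≤qα (*-monoʳ-≤ q (n≤1+n α))))
    2c≤α+3 : c + c ≤ α + 3
    2c≤α+3 = *-cancelˡ-≤ q (begin
      q * (c + c)            ≡⟨ regroup₁ q c ⟩
      2 * (q * c)            ≤⟨ *-monoʳ-≤ 2 qc≤a+q ⟩
      2 * (a + q)            ≡⟨ *-distribˡ-+ 2 a q ⟩
      2 * a + 2 * q          ≤⟨ +-monoˡ-≤ (2 * q) 2a≤q[1+α] ⟩
      q * suc α + 2 * q      ≡⟨ regroup₂ q α ⟩
      q * (α + 3)            ∎)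
      where
      regroup₁ : ∀ q c → q * (c + c) ≡ 2 * (q * c)
      regroup₁ = solve-∀
      regroup₂ : ∀ q α → q * suc α + 2 * q ≡ q * (α + 3)
      regroup₂ = solve-∀
    shares = balanced-share 1≤V 129V≤α 2c≤α+3 c+D≡1+α
  headroom (no 2k'≰qα) = record
    { D = D ; c+D≡1+α = c+D≡1+α ; 8V≤D = proj₁ shares ; 32cV≤D² = proj₂ shares }
    where
    qα<2k' : q * α < 2 * k'
    qα<2k' = ≰⇒> 2k'≰qα
    α<k' : suc α ≤ k'
    α<k' = *-cancelˡ-< 2 α k' (≤-<-trans (*-monoˡ-≤ α 2≤q) qα<2k')
    q<k' : q < k'
    q<k' = *-cancelˡ-< 2 q k' (≤-<-trans (≤-trans (≤-reflexive (*-comm 2 q)) (*-monoʳ-≤ q 2≤α)) qα<2k')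
    a≡k' : a ≡ k'
    a≡k' = m≤n⇒m⊔n≡n α<k'
    qc≤2k' : q * c ≤ 2 * k'
    qc≤2k' = begin
      q * c      ≤⟨ qc≤a+q ⟩
      a + q      ≡⟨ cong (_+ q) a≡k' ⟩
      k' + q     ≤⟨ +-monoʳ-≤ k' (<⇒≤ q<k') ⟩
      k' + k'    ≡⟨ cong (k' +_) (+-identityʳ k') ⟨
      2 * k'     ∎
    g≤qD : g ≤ q * D
    g≤qD = +-cancelˡ-≤ (q * c) g (q * D) (begin
      q * c + g        ≤⟨ +-monoˡ-≤ g qc≤a+q ⟩
      a + q + g        ≡⟨ cong (λ v → v + q + g) a≡k' ⟩
      k' + q + g       ≡⟨ swap k' q g ⟩
      k' + g + q       ≡⟨ cong (_+ q) k'+g≡qα ⟩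
      q * α + q        ≡⟨ +-comm (q * α) q ⟩
      q + q * α        ≡⟨ *-suc q α ⟨
      q * suc α        ≡⟨ cong (q *_) c+D≡1+α ⟨
      q * (c + D)      ≡⟨ *-distribˡ-+ q c D ⟩
      q * c + q * D    ∎)
      where swap : ∀ x y z → x + y + z ≡ x + z + y
            swap = solve-∀
    shares = heavy-share {k' = k'} {c} {D} (≤-trans (s≤s z≤n) 2≤q) 1≤W (≤-trans (s≤s z≤n) 2≤α) L≤α qα<2k' qc≤2k'
               (≤-trans hyp (*-monoˡ-≤ α (*-mono-≤ g≤qD g≤qD)))

indicator : Bool → ℕ
indicator b = if b then 1 else 0

T-does⇒ : ∀ {P : Set} (P? : Dec P) → T (does P?) → P
T-does⇒ (yes p) _ = p

countᵇ-mono-≤ : ∀ {p q : A → Bool} → (∀ x → T (p x) → T (q x)) → ∀ xs → countᵇ p xs ≤ countᵇ q xs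
countᵇ-mono-≤ p⇒q [] = z≤n
countᵇ-mono-≤ {p = p} {q} p⇒q (x ∷ xs) with p x | q x | p⇒q x
... | true  | true  | _    = s≤s (countᵇ-mono-≤ p⇒q xs)
... | true  | false | p⇒qx = ⊥-elim (p⇒qx tt)
... | false | true  | _    = m≤n⇒m≤1+n (countᵇ-mono-≤ p⇒q xs)
... | false | false | _    = countᵇ-mono-≤ p⇒q xs

countᵇ-∨ : ∀ (p q : A → Bool) xs → countᵇ (λ x → p x ∨ q x) xs ≤ countᵇ p xs + countᵇ q xs
countᵇ-∨ p q [] = z≤n
countᵇ-∨ p q (x ∷ xs) with p x | q x
... | true  | true  = s≤s (≤-trans (countᵇ-∨ p q xs) (+-monoʳ-≤ (countᵇ p xs) (n≤1+n _)))
... | true  | false = s≤s (countᵇ-∨ p q xs)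
... | false | true  = ≤-trans (s≤s (countᵇ-∨ p q xs)) (≤-reflexive (sym (+-suc _ _)))
... | false | false = countᵇ-∨ p q xs

countᵇ-zero : ∀ {p : A → Bool} xs → (∀ {x} → x ∈ xs → ¬ T (p x)) → countᵇ p xs ≡ 0
countᵇ-zero [] _ = refl
countᵇ-zero {p = p} (x ∷ xs) ¬p with p x | ¬p (here refl)
... | true  | ¬px = ⊥-elim (¬px tt)
... | false | _   = countᵇ-zero xs (¬p ∘ there)

countᵇ-any : ∀ (P : I → A → Bool) is xs →
             countᵇ (λ x → any (λ i → P i x) is) xs ≤ sum (map (λ i → countᵇ (P i) xs) is)
countᵇ-any P [] xs = ≤-reflexive (countᵇ-zero xs λ _ ())
countᵇ-any P (i ∷ is) xs =
  ≤-trans (countᵇ-∨ (P i) _ xs) (+-monoʳ-≤ (countᵇ (P i) xs) (countᵇ-any P is xs))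

countᵇ-≤1 : ∀ {p : A → Bool} {xs} → Unique xs → (∀ {x y} → T (p x) → T (p y) → x ≡ y) →
            countᵇ p xs ≤ 1
countᵇ-≤1 {xs = []} _ _ = z≤n
countᵇ-≤1 {p = p} {x ∷ xs} (x∉xs ∷ uxs) same with p x in px
... | true  = ≤-reflexive (cong suc (countᵇ-zero xs (λ y∈xs py →
                All.lookup x∉xs y∈xs (same (subst T (sym px) tt) py))))
... | false = countᵇ-≤1 uxs same

countᵇ-*-≤-sum : ∀ {p : A → Bool} (f : A → ℕ) c → (∀ x → T (p x) → c ≤ f x) →
                 ∀ xs → countᵇ p xs * c ≤ sum (map f xs)
countᵇ-*-≤-sum f c large [] = z≤n
countᵇ-*-≤-sum {p = p} f c large (x ∷ xs) with p x | large x
... | true  | c≤fx = +-mono-≤ (c≤fx tt) (countᵇ-*-≤-sum f c large xs)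
... | false | _    = ≤-trans (countᵇ-*-≤-sum f c large xs) (m≤n+m _ (f x))

sum-map-indicator : ∀ (p : A → Bool) xs → sum (map (λ x → indicator (p x)) xs) ≡ countᵇ p xs
sum-map-indicator p [] = refl
sum-map-indicator p (x ∷ xs) with p x
... | true  = cong suc (sum-map-indicator p xs)
... | false = sum-map-indicator p xs

sum-map-+ : ∀ (f g : A → ℕ) xs → sum (map (λ x → f x + g x) xs) ≡ sum (map f xs) + sum (map g xs)
sum-map-+ f g [] = refl
sum-map-+ f g (x ∷ xs) =
  trans (cong (f x + g x +_) (sum-map-+ f g xs)) (+-interchange (f x) (g x) _ _)

sum-map-mono-≤ : ∀ {f g : A → ℕ} → (∀ x → f x ≤ g x) → ∀ xs → sum (map f xs) ≤ sum (map g xs)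
sum-map-mono-≤ f≤g [] = z≤n
sum-map-mono-≤ f≤g (x ∷ xs) = +-mono-≤ (f≤g x) (sum-map-mono-≤ f≤g xs)

sum-map-*ˡ : ∀ a (f : A → ℕ) xs → sum (map (λ x → a * f x) xs) ≡ a * sum (map f xs)
sum-map-*ˡ a f [] = sym (*-zeroʳ a)
sum-map-*ˡ a f (x ∷ xs) = trans (cong (a * f x +_) (sum-map-*ˡ a f xs)) (sym (*-distribˡ-+ a (f x) _))

sum-map-zero : ∀ {f : A → ℕ} → (∀ x → f x ≡ 0) → ∀ xs → sum (map f xs) ≡ 0
sum-map-zero f≡0 [] = refl
sum-map-zero f≡0 (x ∷ xs) = cong₂ _+_ (f≡0 x) (sum-map-zero f≡0 xs)

sum-map-const : ∀ c (xs : List A) → sum (map (λ _ → c) xs) ≡ length xs * c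
sum-map-const c [] = refl
sum-map-const c (_ ∷ xs) = cong (c +_) (sum-map-const c xs)

sum-map-≤ : ∀ (f : A → ℕ) c xs → (∀ {x} → x ∈ xs → f x ≤ c) → sum (map f xs) ≤ length xs * c
sum-map-≤ f c [] _ = z≤n
sum-map-≤ f c (x ∷ xs) f≤c = +-mono-≤ (f≤c (here refl)) (sum-map-≤ f c xs (f≤c ∘ there))

sum-concatMap : ∀ {B : Set} (g : A → List B) (f : B → ℕ) xs →
                sum (map f (concatMap g xs)) ≡ sum (map (λ x → sum (map f (g x))) xs)
sum-concatMap g f [] = refl
sum-concatMap g f (x ∷ xs) = begin-equality
  sum (map f (g x ++ concatMap g xs))                  ≡⟨ cong sum (map-++ f (g x) (concatMap g xs)) ⟩
  sum (map f (g x) ++ map f (concatMap g xs))          ≡⟨ sum-++ (map f (g x)) _ ⟩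
  sum (map f (g x)) + sum (map f (concatMap g xs))     ≡⟨ cong (sum (map f (g x)) +_) (sum-concatMap g f xs) ⟩
  sum (map f (g x)) + sum (map (λ x → sum (map f (g x))) xs) ∎

countᵇ-map : ∀ {B : Set} (p : B → Bool) (f : A → B) xs → countᵇ p (map f xs) ≡ countᵇ (λ x → p (f x)) xs
countᵇ-map p f [] = refl
countᵇ-map p f (x ∷ xs) with p (f x)
... | true  = cong suc (countᵇ-map p f xs)
... | false = countᵇ-map p f xs

union-bound : ∀ (P : I → A → Bool) is xs B N Z → 0 < N → length is ≤ N →
              (∀ {i} → i ∈ is → countᵇ (P i) xs * (B * N) ≤ Z) →
              countᵇ (λ x → any (λ i → P i x) is) xs * B ≤ Z
union-bound P is xs B N Z N>0 |is|≤N each = *-cancelʳ-≤ _ _ N {{>-nonZero N>0}} (begin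
  countᵇ (λ x → any (λ i → P i x) is) xs * B * N     ≤⟨ *-monoˡ-≤ N (*-monoˡ-≤ B (countᵇ-any P is xs)) ⟩
  sum (map (λ i → countᵇ (P i) xs) is) * B * N       ≡⟨ *-assoc (sum (map (λ i → countᵇ (P i) xs) is)) B N ⟩
  sum (map (λ i → countᵇ (P i) xs) is) * (B * N)     ≡⟨ sum-map-*ʳ (λ i → countᵇ (P i) xs) (B * N) is ⟩
  sum (map (λ i → countᵇ (P i) xs * (B * N)) is)     ≤⟨ sum-map-≤ _ Z is each ⟩
  length is * Z                                       ≤⟨ *-monoˡ-≤ Z |is|≤N ⟩
  N * Z                                               ≡⟨ *-comm N Z ⟩
  Z * N                                               ∎)
  where
  sum-map-*ʳ : ∀ (f : I → ℕ) c is → sum (map f is) * c ≡ sum (map (λ i → f i * c) is)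
  sum-map-*ʳ f c [] = refl
  sum-map-*ʳ f c (i ∷ is) = trans (*-distribʳ-+ c (f i) _) (cong (f i * c +_) (sum-map-*ʳ f c is))

T-any⁺ : ∀ {p : A → Bool} {x xs} → x ∈ xs → T (p x) → T (any p xs)
T-any⁺ {p = p} x∈xs px = any⁺ p (Any.map (λ x≡y → subst (T ∘ p) x≡y px) x∈xs)

length-inits : ∀ (xs : List A) → length (inits xs) ≡ suc (length xs)
length-inits [] = refl
length-inits (x ∷ xs) = cong suc (trans (length-map (x ∷_) (inits xs)) (length-inits xs))

∈-inits : ∀ {xs ys zs : List A} → xs ++ ys ≡ zs → xs ∈ inits zs
∈-inits {xs = []} _ = here refl
∈-inits {xs = x ∷ xs} {zs = z ∷ zs} x∷xs++ys≡z∷zs with ∷-injective x∷xs++ys≡z∷zs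
... | refl , xs++ys≡zs = there (∈-map⁺ (x ∷_) (∈-inits xs++ys≡zs))

not-≤ᵇ⇒> : ∀ m n → T (not (m ≤ᵇ n)) → n < m
not-≤ᵇ⇒> m n t with m ≤ᵇ n in m≤ᵇn
... | false = ≰⇒> λ m≤n → subst T m≤ᵇn (≤⇒≤ᵇ m≤n)

>⇒not-≤ᵇ : ∀ {m n} → n < m → T (not (m ≤ᵇ n))
>⇒not-≤ᵇ {m} {n} n<m with m ≤ᵇ n in m≤ᵇn
... | true  = <⇒≱ n<m (≤ᵇ⇒≤ m n (subst T (sym m≤ᵇn) tt))
... | false = tt

-- Exponential moments of bucket loads

-- A hash h : List (Fin q) sends the i-th distinct requested item to bucket h_i; the marks single out
-- the items of a fixed set S. The weight of h is Q ^ (number of marks) · (1 + 1/Q) ^ (load of bucket j),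
-- so that its total over all hashes factorises over the positions.
marked : List Bool → ℕ
marked = countᵇ id

sameBucket : ∀ {q} → Fin q → Fin q → Bool
sameBucket j c = does (c Fin.≟ j)

load : ∀ {q} → Fin q → List Bool → List (Fin q) → ℕ
load j (m ∷ ms) (c ∷ cs) = indicator (m ∧ sameBucket j c) + load j ms cs
load j []       _        = 0
load j (_ ∷ _)  []       = 0

module _ {q : ℕ} (j : Fin q) (Q : ℕ) where

  weight : List Bool → List (Fin q) → ℕ
  weight []           _        = 1
  weight ms@(_ ∷ _)   []       = Q ^ marked ms
  weight (true ∷ ms)  (c ∷ cs) = (if sameBucket j c then suc Q else Q) * weight ms cs
  weight (false ∷ ms) (c ∷ cs) = weight ms cs

  totalWeight : List Bool → ℕ
  totalWeight []           = 1
  totalWeight (true ∷ ms)  = suc (q * Q) * totalWeight ms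
  totalWeight (false ∷ ms) = q * totalWeight ms

  weight-load : ∀ ms h → weight ms h * Q ^ load j ms h ≡ suc Q ^ load j ms h * Q ^ marked ms
  weight-load []          h        = refl
  weight-load ms@(_ ∷ _)  []       = trans (*-identityʳ _) (sym (+-identityʳ _))
  weight-load (false ∷ ms) (c ∷ cs) = weight-load ms cs
  weight-load (true ∷ ms) (c ∷ cs) with sameBucket j c
  ... | true = begin-equality
      suc Q * W * (Q * Q ^ L)              ≡⟨ *-interchange (suc Q) W Q (Q ^ L) ⟩
      suc Q * Q * (W * Q ^ L)              ≡⟨ cong (suc Q * Q *_) (weight-load ms cs) ⟩
      suc Q * Q * (suc Q ^ L * Q ^ M)      ≡⟨ *-interchange (suc Q) Q (suc Q ^ L) (Q ^ M) ⟩
      suc Q ^ suc L * Q ^ suc M            ∎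
    where
    W = weight ms cs
    L = load j ms cs
    M = marked ms
  ... | false = begin-equality
      Q * W * Q ^ L                        ≡⟨ *-assoc Q W (Q ^ L) ⟩
      Q * (W * Q ^ L)                      ≡⟨ cong (Q *_) (weight-load ms cs) ⟩
      Q * (suc Q ^ L * Q ^ M)              ≡⟨ *-x∙yz≈y∙xz Q (suc Q ^ L) (Q ^ M) ⟩
      suc Q ^ L * (Q * Q ^ M)              ∎
    where
    W = weight ms cs
    L = load j ms cs
    M = marked ms

  weight-heavy : ∀ m ms h → 0 < Q → m ≤ load j ms h → suc Q ^ m * Q ^ marked ms ≤ weight ms h * Q ^ m
  weight-heavy m ms h Q>0 m≤L = *-cancelʳ-≤′ _ _ (Q ^ L) (m^n>0 Q {{>-nonZero Q>0}} L) (begin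
    suc Q ^ m * Q ^ M * Q ^ L    ≡⟨ swap (suc Q ^ m) (Q ^ M) (Q ^ L) ⟩
    suc Q ^ m * Q ^ L * Q ^ M    ≤⟨ *-monoˡ-≤ (Q ^ M) (^-cross-≤ (n≤1+n Q) m≤L) ⟩
    suc Q ^ L * Q ^ m * Q ^ M    ≡⟨ swap (suc Q ^ L) (Q ^ m) (Q ^ M) ⟩
    suc Q ^ L * Q ^ M * Q ^ m    ≡⟨ cong (_* Q ^ m) (weight-load ms h) ⟨
    weight ms h * Q ^ L * Q ^ m  ≡⟨ swap (weight ms h) (Q ^ L) (Q ^ m) ⟩
    weight ms h * Q ^ m * Q ^ L  ∎)
    where
    L = load j ms h
    M = marked ms
    swap : ∀ a b c → a * b * c ≡ a * c * b
    swap = solve-∀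

  sum-weight : ∀ ms → sum (map (weight ms) (allHashes q (length ms))) ≤ totalWeight ms
  sum-weight [] = ≤-refl
  sum-weight (m ∷ ms) = begin
    sum (map (weight (m ∷ ms)) (concatMap (λ c → map (c ∷_) H) (allFin q)))
      ≡⟨ sum-concatMap (λ c → map (c ∷_) H) (weight (m ∷ ms)) (allFin q) ⟩
    sum (map (λ c → sum (map (weight (m ∷ ms)) (map (c ∷_) H))) (allFin q))
      ≡⟨ cong sum (map-cong (λ c → cong sum (sym (map-∘ H))) (allFin q)) ⟩
    sum (map (λ c → sum (map (λ cs → weight (m ∷ ms) (c ∷ cs)) H)) (allFin q))
      ≤⟨ first-position m ⟩
    totalWeight (m ∷ ms) ∎
    where
    H = allHashes q (length ms)
    rest = sum (map (weight ms) H)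
    q* : ∀ c → sum (map (λ _ → c) (allFin q)) ≡ q * c
    q* c = trans (sum-map-const c (allFin q)) (cong (_* c) (length-tabulate {n = q} id))
    bucket-weights : sum (map (λ c → if sameBucket j c then suc Q else Q) (allFin q)) ≤ suc (q * Q)
    bucket-weights = begin
      sum (map (λ c → if sameBucket j c then suc Q else Q) (allFin q))
        ≡⟨ cong sum (map-cong (λ c → split (sameBucket j c)) (allFin q)) ⟩
      sum (map (λ c → Q + indicator (sameBucket j c)) (allFin q))
        ≡⟨ sum-map-+ (λ _ → Q) (λ c → indicator (sameBucket j c)) (allFin q) ⟩
      sum (map (λ _ → Q) (allFin q)) + sum (map (λ c → indicator (sameBucket j c)) (allFin q))
        ≡⟨ cong₂ _+_ (q* Q) (sum-map-indicator (sameBucket j) (allFin q)) ⟩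
      q * Q + countᵇ (sameBucket j) (allFin q)
        ≤⟨ +-monoʳ-≤ (q * Q) (countᵇ-≤1 (allFin⁺ q) (λ c≡j c′≡j → trans (T-does⇒ (_ Fin.≟ j) c≡j) (sym (T-does⇒ (_ Fin.≟ j) c′≡j)))) ⟩
      q * Q + 1
        ≡⟨ +-comm (q * Q) 1 ⟩
      suc (q * Q) ∎
      where
      split : ∀ b → (if b then suc Q else Q) ≡ Q + indicator b
      split true  = sym (+-comm Q 1)
      split false = sym (+-identityʳ Q)
    first-position : ∀ m → sum (map (λ c → sum (map (λ cs → weight (m ∷ ms) (c ∷ cs)) H)) (allFin q)) ≤ totalWeight (m ∷ ms)
    first-position false = begin
      sum (map (λ _ → rest) (allFin q))  ≡⟨ q* rest ⟩
      q * rest                        ≤⟨ *-monoʳ-≤ q (sum-weight ms) ⟩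
      q * totalWeight ms              ∎
    first-position true = begin
      sum (map (λ c → sum (map (λ cs → (if sameBucket j c then suc Q else Q) * weight ms cs) H)) (allFin q))
        ≡⟨ cong sum (map-cong (λ c → trans (sum-map-*ˡ (if sameBucket j c then suc Q else Q) (weight ms) H) (*-comm _ rest)) (allFin q)) ⟩
      sum (map (λ c → rest * (if sameBucket j c then suc Q else Q)) (allFin q))
        ≡⟨ sum-map-*ˡ rest (λ c → if sameBucket j c then suc Q else Q) (allFin q) ⟩
      rest * sum (map (λ c → if sameBucket j c then suc Q else Q) (allFin q))
        ≤⟨ *-mono-≤ (sum-weight ms) bucket-weights ⟩
      totalWeight ms * suc (q * Q)
        ≡⟨ *-comm (totalWeight ms) _ ⟩
      suc (q * Q) * totalWeight ms ∎

  totalWeight-marked : ∀ ms → totalWeight ms * q ^ marked ms ≡ suc (q * Q) ^ marked ms * q ^ length ms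
  totalWeight-marked [] = refl
  totalWeight-marked (true ∷ ms) = begin-equality
    suc (q * Q) * totalWeight ms * (q * q ^ marked ms)        ≡⟨ *-interchange (suc (q * Q)) (totalWeight ms) q (q ^ marked ms) ⟩
    suc (q * Q) * q * (totalWeight ms * q ^ marked ms)        ≡⟨ cong (suc (q * Q) * q *_) (totalWeight-marked ms) ⟩
    suc (q * Q) * q * (suc (q * Q) ^ marked ms * q ^ length ms) ≡⟨ *-interchange (suc (q * Q)) q (suc (q * Q) ^ marked ms) (q ^ length ms) ⟩
    suc (q * Q) ^ suc (marked ms) * q ^ suc (length ms)       ∎
  totalWeight-marked (false ∷ ms) = begin-equality
    q * totalWeight ms * q ^ marked ms                  ≡⟨ *-assoc q (totalWeight ms) _ ⟩
    q * (totalWeight ms * q ^ marked ms)                ≡⟨ cong (q *_) (totalWeight-marked ms) ⟩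
    q * (suc (q * Q) ^ marked ms * q ^ length ms)       ≡⟨ *-x∙yz≈y∙xz q (suc (q * Q) ^ marked ms) (q ^ length ms) ⟩
    suc (q * Q) ^ marked ms * (q * q ^ length ms)       ∎

  heavy-hashes : ∀ m ms → 0 < Q →
    countᵇ (λ h → m ≤ᵇ load j ms h) (allHashes q (length ms)) * (suc Q ^ m * Q ^ marked ms) ≤
    Q ^ m * totalWeight ms
  heavy-hashes m ms Q>0 = begin
    countᵇ (λ h → m ≤ᵇ load j ms h) H * (suc Q ^ m * Q ^ marked ms)
      ≤⟨ countᵇ-*-≤-sum (λ h → Q ^ m * weight ms h) _
           (λ h heavy → ≤-trans (weight-heavy m ms h Q>0 (≤ᵇ⇒≤ m _ heavy)) (≤-reflexive (*-comm _ (Q ^ m)))) H ⟩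
    sum (map (λ h → Q ^ m * weight ms h) H)
      ≡⟨ sum-map-*ˡ (Q ^ m) (weight ms) H ⟩
    Q ^ m * sum (map (weight ms) H)
      ≤⟨ *-monoʳ-≤ (Q ^ m) (sum-weight ms) ⟩
    Q ^ m * totalWeight ms ∎
    where
    H = allHashes q (length ms)

k<2^[1+⌊log₂k⌋] : ∀ k → k < 2 ^ suc ⌊log₂ k ⌋
k<2^[1+⌊log₂k⌋] k = ≰⇒> λ 2^[1+L]≤k →
  1+n≰n (subst (_≤ ⌊log₂ k ⌋) (⌊log₂[2^n]⌋≡n (suc ⌊log₂ k ⌋)) (⌊log₂⌋-mono-≤ 2^[1+L]≤k))

union-weight-≤ : ∀ k d e → 1 ≤ k → k ^ e * (k ^ d + 1) * k ≤ 2 ^ suc (suc ⌊log₂ k ⌋ * (e + d + 1))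
union-weight-≤ k d e 1≤k = begin
  k ^ e * (k ^ d + 1) * k           ≤⟨ *-monoˡ-≤ k (*-monoʳ-≤ (k ^ e) (+-monoʳ-≤ (k ^ d) (m^n>0 k {{>-nonZero 1≤k}} d))) ⟩
  k ^ e * (k ^ d + k ^ d) * k       ≡⟨ double (k ^ e) (k ^ d) k ⟩
  2 * (k ^ e * k ^ d * k)           ≡⟨ cong (2 *_) k^[e+d+1] ⟨
  2 * k ^ (e + d + 1)               ≤⟨ *-monoʳ-≤ 2 (^-monoˡ-≤ (e + d + 1) (<⇒≤ (k<2^[1+⌊log₂k⌋] k))) ⟩
  2 * (2 ^ suc ⌊log₂ k ⌋) ^ (e + d + 1) ≡⟨ cong (2 *_) (^-*-assoc 2 (suc ⌊log₂ k ⌋) (e + d + 1)) ⟩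
  2 ^ suc (suc ⌊log₂ k ⌋ * (e + d + 1)) ∎
  where
  double : ∀ a b c → a * (b + b) * c ≡ 2 * (a * b * c)
  double = solve-∀
  k^[e+d+1] : k ^ (e + d + 1) ≡ k ^ e * k ^ d * k
  k^[e+d+1] = trans (^-distribˡ-+-* k (e + d) 1) (cong₂ _*_ (^-distribˡ-+-* k e d) (*-identityʳ k))

logFactor : ℕ → ℕ → ℕ
logFactor d e = 2 * (e + d + 2)

union-exponent-≤ : ∀ L d e → 1 ≤ L → suc (suc (suc L * (e + d + 1))) ≤ logFactor d e * L
union-exponent-≤ (suc L) d e _ = ≤-trans (m≤m+n _ (L * (e + d + 3))) (≤-reflexive (expand L d e))
  where expand : ∀ L d e → suc (suc (suc (suc L) * (e + d + 1))) + L * (e + d + 3) ≡ 2 * (e + d + 2) * suc L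
        expand = solve-∀

module _ {U : Set} (_≟_ : DecidableEquality U) where
  open Paging _≟_
  open DecMembership _≟_ using (_∈?_)

  unique-⊆⇒length-≤ : ∀ {xs ys : List U} → Unique xs → xs ⊆ ys → length xs ≤ length ys
  unique-⊆⇒length-≤ {[]} _ _ = z≤n
  unique-⊆⇒length-≤ {x ∷ xs} {ys} (x∉xs ∷ uxs) xs⊆ys = begin-strict
    length xs                       ≤⟨ unique-⊆⇒length-≤ uxs xs⊆ys∖x ⟩
    length (filter (¬? ∘ (_≟ x)) ys) <⟨ filter-notAll (¬? ∘ (_≟ x)) ys
                                          (Any.map (λ x≡y y≢x → y≢x (sym x≡y)) (xs⊆ys (here refl))) ⟩
    length ys                       ∎
    where
    xs⊆ys∖x : xs ⊆ filter (¬? ∘ (_≟ x)) ys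
    xs⊆ys∖x y∈xs = ∈-filter⁺ (¬? ∘ (_≟ x)) (xs⊆ys (there y∈xs)) (λ y≡x → All.lookup x∉xs y∈xs (sym y≡x))

  ⊆? : ∀ (xs ys : List U) → (∃ λ y → y ∈ xs × y ∉ ys) ⊎ xs ⊆ ys
  ⊆? xs ys with all? (_∈? ys) xs
  ... | yes xs⊆ys = inj₂ (All.lookup xs⊆ys)
  ... | no xs⊈ys  = inj₁ (find (¬All⇒Any¬ (_∈? ys) xs xs⊈ys))

  restrict-all : ∀ τ → restrict (λ _ → true) τ ≡ τ
  restrict-all τ = filter-all (T? ∘ λ _ → true) (All.universal _ τ)

  restrict-∷ʳ-accept : ∀ X τ {z} → T (X z) → restrict X (τ ∷ʳ z) ≡ restrict X τ ∷ʳ z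
  restrict-∷ʳ-accept X τ {z} Xz =
    trans (filter-++ (T? ∘ X) τ (z ∷ [])) (cong (restrict X τ ++_) (filter-accept (T? ∘ X) Xz))

  restrict-∷ʳ-reject : ∀ X τ {z} → ¬ T (X z) → restrict X (τ ∷ʳ z) ≡ restrict X τ
  restrict-∷ʳ-reject X τ {z} ¬Xz =
    trans (filter-++ (T? ∘ X) τ (z ∷ []))
          (trans (cong (restrict X τ ++_) (filter-reject (T? ∘ X) ¬Xz)) (++-identityʳ (restrict X τ)))

  marks : List U → List U → List Bool
  marks S ys = map (λ y → does (y ∈? S)) ys

  marked-marks-≤ : ∀ S ys → Unique ys → marked (marks S ys) ≤ length S
  marked-marks-≤ S ys uys = begin
    countᵇ id (map (λ y → does (y ∈? S)) ys)   ≡⟨ countᵇ-map id _ ys ⟩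
    countᵇ (λ y → does (y ∈? S)) ys            ≤⟨ unique-⊆⇒length-≤ (filter⁺ _ uys)
                                                    (T-does⇒ (_ ∈? S) ∘ proj₂ ∘ ∈-filter⁻ (T? ∘ λ y → does (y ∈? S)) {xs = ys}) ⟩
    length S                                   ∎

  inBucket-load-≤ : ∀ {q} (j : Fin q) ys h S → Unique S → countᵇ (inBucket ys h j) S ≤ load j (marks S ys) h
  inBucket-load-≤ j []       h        S uS = ≤-reflexive (countᵇ-zero S λ _ ())
  inBucket-load-≤ j (y ∷ ys) []       S uS = ≤-reflexive (countᵇ-zero S λ _ ())
  inBucket-load-≤ j (y ∷ ys) (c ∷ cs) S uS = begin
    countᵇ (inBucket (y ∷ ys) (c ∷ cs) j) S
      ≤⟨ countᵇ-mono-≤ unfold S ⟩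
    countᵇ (λ x → (does (x ≟ y) ∧ sameBucket j c) ∨ inBucket ys cs j x) S
      ≤⟨ countᵇ-∨ _ _ S ⟩
    countᵇ (λ x → does (x ≟ y) ∧ sameBucket j c) S + countᵇ (inBucket ys cs j) S
      ≤⟨ +-mono-≤ head (inBucket-load-≤ j ys cs S uS) ⟩
    indicator (does (y ∈? S) ∧ sameBucket j c) + load j (marks S ys) cs ∎
    where
    unfold : ∀ x → T (inBucket (y ∷ ys) (c ∷ cs) j x) → T ((does (x ≟ y) ∧ sameBucket j c) ∨ inBucket ys cs j x)
    unfold x in-j with does (x ≟ y)
    ... | true  = Equivalence.from T-∨ (inj₁ in-j)
    ... | false = in-j
    head : countᵇ (λ x → does (x ≟ y) ∧ sameBucket j c) S ≤ indicator (does (y ∈? S) ∧ sameBucket j c)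
    head with sameBucket j c | y ∈? S
    ... | false | _ = ≤-trans (≤-reflexive (countᵇ-zero S λ _ t → proj₂ (Equivalence.to T-∧ t))) z≤n
    ... | true | no y∉S = ≤-reflexive (countᵇ-zero S λ x∈S t →
                            y∉S (subst (_∈ S) (T-does⇒ (_ ≟ y) (proj₁ (Equivalence.to T-∧ t))) x∈S))
    ... | true | yes _ = countᵇ-≤1 uS λ tx ty →
                            trans (T-does⇒ (_ ≟ y) (proj₁ (Equivalence.to T-∧ tx))) (sym (T-does⇒ (_ ≟ y) (proj₁ (Equivalence.to T-∧ ty))))

  bucket-tail : ∀ {q c D E} (P : TailParameters c D E) (j : Fin q) ys S α K → 0 < q →
                Unique S → Unique ys → length S ≤ q * c → c + D ≡ suc α → K ≤ 2 ^ E →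
                countᵇ (λ h → not (countᵇ (inBucket ys h j) S ≤ᵇ α)) (allHashes q (length ys)) * K ≤ q ^ length ys
  bucket-tail {q} {c} {D} P j ys S α K q>0 uS uys |S|≤qc c+D≡1+α K≤2^E =
    *-cancelʳ-≤′ _ _ (suc Q ^ m * (q * Q) ^ s)
      (*-mono-≤ (m^n>0 (suc Q) m) (m^n>0 (q * Q) {{>-nonZero (*-mono-≤ q>0 (s≤s z≤n))}} s)) (begin
      over * K * (suc Q ^ m * (q * Q) ^ s)
        ≡⟨ cong (λ v → over * K * (suc Q ^ m * v)) (^-distribʳ-* q Q s) ⟩
      over * K * (suc Q ^ m * (q ^ s * Q ^ s))
        ≡⟨ regroup₁ over K (suc Q ^ m) (q ^ s) (Q ^ s) ⟩
      K * (over * (suc Q ^ m * Q ^ s)) * q ^ s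
        ≤⟨ *-monoˡ-≤ (q ^ s) (*-monoʳ-≤ K markov) ⟩
      K * (Q ^ m * totalWeight j Q ms) * q ^ s
        ≡⟨ regroup₂ K (Q ^ m) (totalWeight j Q ms) (q ^ s) ⟩
      K * Q ^ m * (totalWeight j Q ms * q ^ s)
        ≡⟨ cong (K * Q ^ m *_) (trans (totalWeight-marked j Q ms) (cong (λ v → suc (q * Q) ^ s * q ^ v) |ms|≡n)) ⟩
      K * Q ^ m * (suc (q * Q) ^ s * q ^ n)
        ≡⟨ regroup₃ K (Q ^ m) (suc (q * Q) ^ s) (q ^ n) ⟩
      suc (q * Q) ^ s * Q ^ m * K * q ^ n
        ≤⟨ *-monoˡ-≤ (q ^ n) arithmetic ⟩
      suc Q ^ m * (q * Q) ^ s * q ^ n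
        ≡⟨ *-comm _ (q ^ n) ⟩
      q ^ n * (suc Q ^ m * (q * Q) ^ s) ∎)
    where
    open TailParameters P using (r)
    Q = suc r
    m = suc α
    ms = marks S ys
    s = marked ms
    n = length ys
    |ms|≡n : length ms ≡ n
    |ms|≡n = length-map _ ys
    over = countᵇ (λ h → not (countᵇ (inBucket ys h j) S ≤ᵇ α)) (allHashes q n)
    overloaded⇒heavy : ∀ h → T (not (countᵇ (inBucket ys h j) S ≤ᵇ α)) → T (m ≤ᵇ load j ms h)
    overloaded⇒heavy h overloaded = ≤⇒≤ᵇ (≤-trans (not-≤ᵇ⇒> _ α overloaded) (inBucket-load-≤ j ys h S uS))
    markov : over * (suc Q ^ m * Q ^ s) ≤ Q ^ m * totalWeight j Q ms
    markov = ≤-trans (*-monoˡ-≤ _ (countᵇ-mono-≤ overloaded⇒heavy (allHashes q n)))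
               (subst (λ v → countᵇ (λ h → m ≤ᵇ load j ms h) (allHashes q v) * (suc Q ^ m * Q ^ s) ≤ Q ^ m * totalWeight j Q ms)
                      |ms|≡n (heavy-hashes j Q m ms (s≤s z≤n)))
    arithmetic : suc (q * Q) ^ s * Q ^ m * K ≤ suc Q ^ m * (q * Q) ^ s
    arithmetic = subst (λ v → suc (q * Q) ^ s * Q ^ v * K ≤ suc Q ^ v * (q * Q) ^ s) c+D≡1+α
                   (tail-arithmetic P q s K q>0 (≤-trans (marked-marks-≤ S ys uys) |S|≤qc) K≤2^E)
    regroup₁ : ∀ a k p x y → a * k * (p * (x * y)) ≡ k * (a * (p * y)) * x
    regroup₁ = solve-∀
    regroup₂ : ∀ k p w x → k * (p * w) * x ≡ k * p * (w * x)
    regroup₂ = solve-∀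
    regroup₃ : ∀ k w a b → k * w * (a * b) ≡ a * w * k * b
    regroup₃ = solve-∀

  inBucket-functional : ∀ {q} ys (h : List (Fin q)) {x j j′} →
                        T (inBucket ys h j x) → T (inBucket ys h j′ x) → j ≡ j′
  inBucket-functional []       h        ()
  inBucket-functional (y ∷ ys) []       ()
  inBucket-functional (y ∷ ys) (c ∷ cs) {x} {j} {j′} in-j in-j′ with does (x ≟ y)
  ... | false = inBucket-functional ys cs in-j in-j′
  ... | true  = trans (sym (T-does⇒ (c Fin.≟ j) in-j)) (T-does⇒ (c Fin.≟ j′) in-j′)

  -- Lazy stable paging

  module _ (A : PagingAlg) where

    LoadBounded : (U → Bool) → ℕ → ℕ → List U → Set
    LoadBounded X a α τ = ∀ τ' ρ → τ' ++ ρ ≡ τ → countᵇ X (cache A a τ') ≤ α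

    LoadBounded-∷ʳ⁻ : ∀ {X a α τ z} → LoadBounded X a α (τ ∷ʳ z) → LoadBounded X a α τ
    LoadBounded-∷ʳ⁻ {z = z} load τ' ρ τ'++ρ≡τ =
      load τ' (ρ ∷ʳ z) (trans (sym (++-assoc τ' ρ (z ∷ []))) (cong (_∷ʳ z) τ'++ρ≡τ))

    missesFrom-restrict-∷ : ∀ X α pre x rest →
      missesFrom A α (restrict X pre) (restrict X (x ∷ rest)) ≡
      indicator (X x ∧ not (does (x ∈? cache A α (restrict X pre)))) +
      missesFrom A α (restrict X (pre ∷ʳ x)) (restrict X rest)
    missesFrom-restrict-∷ X α pre x rest with X x in Xx
    ... | true  rewrite restrict-∷ʳ-accept X pre {x} (Equivalence.from T-≡ Xx) =
      cong (_+ missesFrom A α (restrict X pre ∷ʳ x) (restrict X rest)) (miss-indicator _)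
      where miss-indicator : ∀ d → (if d then 0 else 1) ≡ indicator (not d)
            miss-indicator true  = refl
            miss-indicator false = refl
    ... | false rewrite restrict-∷ʳ-reject X pre {x} (subst T Xx) = refl

    bucket-misses-≤ : ∀ {q} (X : Fin q → U → Bool) k α σ →
      (∀ {x j j'} → T (X j x) → T (X j' x) → j ≡ j') →
      (∀ τ ρ → τ ++ ρ ≡ σ → ∀ j {w} → w ∈ cache A k τ → T (X j w) → w ∈ cache A α (restrict (X j) τ)) →
      ∀ pre rest → pre ++ rest ≡ σ →
      sum (map (λ j → missesFrom A α (restrict (X j) pre) (restrict (X j) rest)) (allFin q)) ≤
      missesFrom A k pre rest
    bucket-misses-≤ {q} X k α σ exclusive dominated pre [] _ =
      ≤-reflexive (sum-map-zero (λ _ → refl) (allFin q))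
    bucket-misses-≤ {q} X k α σ exclusive dominated pre (x ∷ rest) pre++x∷rest≡σ = begin
      sum (map (λ j → missesFrom A α (restrict (X j) pre) (restrict (X j) (x ∷ rest))) (allFin q))
        ≡⟨ cong sum (map-cong (λ j → missesFrom-restrict-∷ (X j) α pre x rest) (allFin q)) ⟩
      sum (map (λ j → now j + later j) (allFin q))
        ≡⟨ sum-map-+ now later (allFin q) ⟩
      sum (map now (allFin q)) + sum (map later (allFin q))
        ≤⟨ +-mono-≤ bucket-hits (bucket-misses-≤ X k α σ exclusive dominated (pre ∷ʳ x) rest
                                   (trans (++-assoc pre (x ∷ []) rest) pre++x∷rest≡σ)) ⟩
      (if does (x ∈? cache A k pre) then 0 else 1) + missesFrom A k (pre ∷ʳ x) rest ∎
      where
      now later : Fin q → ℕ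
      now j = indicator (X j x ∧ not (does (x ∈? cache A α (restrict (X j) pre))))
      later j = missesFrom A α (restrict (X j) (pre ∷ʳ x)) (restrict (X j) rest)
      bucket-hits : sum (map now (allFin q)) ≤ (if does (x ∈? cache A k pre) then 0 else 1)
      bucket-hits with x ∈? cache A k pre
      ... | yes x∈ = ≤-reflexive (sum-map-zero no-miss (allFin q))
        where
        no-miss : ∀ j → now j ≡ 0
        no-miss j with X j x in Xjx
        ... | false = refl
        ... | true with x ∈? cache A α (restrict (X j) pre)
        ...   | yes _  = refl
        ...   | no x∉ = contradiction (dominated pre (x ∷ rest) pre++x∷rest≡σ j x∈ (Equivalence.from T-≡ Xjx)) x∉
      ... | no _ = begin
        sum (map now (allFin q))                         ≤⟨ sum-map-mono-≤ now≤ (allFin q) ⟩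
        sum (map (λ j → indicator (X j x)) (allFin q))   ≡⟨ sum-map-indicator (λ j → X j x) (allFin q) ⟩
        countᵇ (λ j → X j x) (allFin q)                  ≤⟨ countᵇ-≤1 (allFin⁺ q) exclusive ⟩
        1                                                ∎
        where
        now≤ : ∀ j → now j ≤ indicator (X j x)
        now≤ j with X j x
        ... | false = z≤n
        ... | true with does (x ∈? cache A α (restrict (X j) pre))
        ...   | true  = z≤n
        ...   | false = ≤-refl

  module _ (A : PagingAlg) (lazy : Lazy A) where
    open Lazy lazy

    ∈-cache-∷ʳ : ∀ k .{{_ : NonZero k}} σ x → x ∈ cache A k (σ ∷ʳ x)
    ∈-cache-∷ʳ k σ x with x ∈? cache A k σ
    ... | yes x∈ = Equivalence.from (hit k σ x x∈ x) x∈
    ... | no x∉  = fetch k σ x x∉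

    cache-∷ʳ⁻ : ∀ k .{{_ : NonZero k}} σ x {y} → y ∈ cache A k (σ ∷ʳ x) → y ≡ x ⊎ y ∈ cache A k σ
    cache-∷ʳ⁻ k σ x {y} y∈ with x ∈? cache A k σ
    ... | yes x∈ = inj₂ (Equivalence.to (hit k σ x x∈ y) y∈)
    ... | no x∉  = only-x k σ x x∉ y y∈

    eviction⇒miss : ∀ k .{{_ : NonZero k}} σ x {y} →
                    y ∈ cache A k σ → y ∉ cache A k (σ ∷ʳ x) → x ∉ cache A k σ
    eviction⇒miss k σ x {y} y∈ y∉ x∈ = y∉ (Equivalence.from (hit k σ x x∈ y) y∈)

    cache⊆requests : ∀ k σ → cache A k σ ⊆ σ
    cache⊆requests zero σ {y} y∈ with cache A 0 σ | cache-size A 0 σ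
    cache⊆requests zero σ () | [] | _
    cache⊆requests k@(suc _) σ = go (reverseView σ)
      where
      go : ∀ {σ} → Reverse σ → cache A k σ ⊆ σ
      go [] y∈ = ⊥-elim (empty k _ y∈)
      go (σ ∶ rσ ∶ʳ x) y∈ with cache-∷ʳ⁻ k σ x y∈
      ... | inj₁ refl = ∈-++⁺ʳ σ (here refl)
      ... | inj₂ y∈σ  = ∈-++⁺ˡ (go rσ y∈σ)

    -- on an eviction of y, the old cache sits inside y plus the new cache minus x
    cache-length-mono : ∀ k .{{_ : NonZero k}} σ x → length (cache A k σ) ≤ length (cache A k (σ ∷ʳ x))
    cache-length-mono k σ x with ⊆? (cache A k σ) (cache A k (σ ∷ʳ x))
    ... | inj₂ old⊆new = unique-⊆⇒length-≤ (cache-uniq A k σ) old⊆new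
    ... | inj₁ (y , y∈ , y∉) = begin
      length old                                ≤⟨ unique-⊆⇒length-≤ (cache-uniq A k σ) old⊆y∷new∖x ⟩
      suc (length (filter (¬? ∘ (_≟ x)) new))   ≤⟨ filter-notAll (¬? ∘ (_≟ x)) new
                                                     (Any.map (λ x≡z z≢x → z≢x (sym x≡z)) (∈-cache-∷ʳ k σ x)) ⟩
      length new                                ∎
      where
      old = cache A k σ
      new = cache A k (σ ∷ʳ x)
      x∉old = eviction⇒miss k σ x y∈ y∉
      old⊆y∷new∖x : old ⊆ y ∷ filter (¬? ∘ (_≟ x)) new
      old⊆y∷new∖x {z} z∈ with z ∈? new
      ... | yes z∈new = there (∈-filter⁺ (¬? ∘ (_≟ x)) z∈new (λ { refl → x∉old z∈ }))
      ... | no z∉new  = here (one-out k σ x x∉old z y z∈ z∉new y∈ y∉)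

    unfull-cache-holds-requests : ∀ k .{{_ : NonZero k}} σ → length (cache A k σ) < k → σ ⊆ cache A k σ
    unfull-cache-holds-requests k σ = go (reverseView σ)
      where
      go : ∀ {σ} → Reverse σ → length (cache A k σ) < k → σ ⊆ cache A k σ
      go [] _ ()
      go (σ ∶ rσ ∶ʳ x) unfull {y} y∈ with ∈-++⁻ σ y∈
      ... | inj₂ (here refl) = ∈-cache-∷ʳ k σ y
      ... | inj₁ y∈σ with y ∈? cache A k (σ ∷ʳ x)
      ...   | yes y∈new = y∈new
      ...   | no y∉new  = contradiction (full k σ x (eviction⇒miss k σ x y∈old y∉new) y y∈old y∉new) (<⇒≢ unfullσ)
        where
        unfullσ = ≤-<-trans (cache-length-mono k σ x) unfull
        y∈old = go rσ unfullσ y∈σ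

    module _ (stable : Stable A) where

      stable-unrestricted : ∀ σ x {a b} → b < a → 1 ≤ b →
        (∃ λ v → InOut A b σ x v × v ∈ cache A a (σ ∷ʳ x)) → cache A b (σ ∷ʳ x) ⊆ cache A a (σ ∷ʳ x)
      stable-unrestricted σ x {a} {b} b<a 1≤b eviction {y} y∈ =
        stable σ (λ _ → true) x refl a b b<a 1≤b
          (subst (λ τ → ∃ λ v → InOut A b τ x v × v ∈ cache A a (σ ∷ʳ x)) (sym (restrict-all σ)) eviction)
          y (subst (λ τ → y ∈ cache A b (τ ∷ʳ x)) (sym (restrict-all σ)) y∈)

      cache-inclusion : ∀ {a b} .{{_ : NonZero b}} → b < a → ∀ σ → cache A b σ ⊆ cache A a σ
      cache-inclusion {a@(suc _)} {b} b<a σ = go (reverseView σ)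
        where
        step : ∀ σ x → cache A b σ ⊆ cache A a σ → cache A b (σ ∷ʳ x) ⊆ cache A a (σ ∷ʳ x)
        step σ x b⊆a {y} y∈ with cache-∷ʳ⁻ b σ x y∈
        ... | inj₁ refl = ∈-cache-∷ʳ a σ y
        ... | inj₂ y∈bσ with y ∈? cache A a (σ ∷ʳ x)
        ...   | yes y∈aσx = y∈aσx
        ...   | no y∉aσx with ⊆? (cache A b σ) (cache A b (σ ∷ʳ x))
        ...     | inj₁ (v , v∈bσ , v∉bσx) with v ∈? cache A a (σ ∷ʳ x)
        ...       | yes v∈aσx = stable-unrestricted σ x b<a (>-nonZero⁻¹ b) (v , (v∈bσ , v∉bσx) , v∈aσx) y∈
        ...       | no v∉aσx  = contradiction (subst (_∈ cache A b (σ ∷ʳ x)) (sym v≡y) y∈) v∉bσx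
          where v≡y = one-out a σ x (eviction⇒miss a σ x (b⊆a y∈bσ) y∉aσx) v y (b⊆a v∈bσ) v∉aσx (b⊆a y∈bσ) y∉aσx
        step σ x b⊆a {y} y∈ | inj₂ y∈bσ | no y∉aσx | inj₂ bσ⊆bσx = contradiction a<a (<-irrefl refl)
          where
          x∉aσ = eviction⇒miss a σ x (b⊆a y∈bσ) y∉aσx
          x∉bσ : x ∉ cache A b σ
          x∉bσ = x∉aσ ∘ b⊆a
          x∷bσ⊆bσx : x ∷ cache A b σ ⊆ cache A b (σ ∷ʳ x)
          x∷bσ⊆bσx (here refl) = ∈-cache-∷ʳ b σ x
          x∷bσ⊆bσx (there z∈) = bσ⊆bσx z∈
          bσ-unfull : length (cache A b σ) < b
          bσ-unfull = ≤-trans (unique-⊆⇒length-≤ (¬Any⇒All¬ _ x∉bσ ∷ cache-uniq A b σ) x∷bσ⊆bσx)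
                              (cache-size A b (σ ∷ʳ x))
          a<a : a < a
          a<a = begin-strict
            a                     ≡⟨ full a σ x x∉aσ y (b⊆a y∈bσ) y∉aσx ⟨
            length (cache A a σ)  ≤⟨ unique-⊆⇒length-≤ (cache-uniq A a σ)
                                       (unfull-cache-holds-requests b σ bσ-unfull ∘ cache⊆requests a σ) ⟩
            length (cache A b σ)  <⟨ bσ-unfull ⟩
            b                     <⟨ b<a ⟩
            a                     ∎
        go : ∀ {σ} → Reverse σ → cache A b σ ⊆ cache A a σ
        go [] y∈ = ⊥-elim (empty b _ y∈)
        go (σ ∶ rσ ∶ʳ x) = step σ x (go rσ)

      bucket-inclusion : ∀ X {a α} .{{_ : NonZero α}} → α < a → ∀ τ → LoadBounded A X a α τ →
                         ∀ {w} → w ∈ cache A a τ → T (X w) → w ∈ cache A α (restrict X τ)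
      bucket-inclusion X {a@(suc _)} {α} α<a τ = go (reverseView τ)
        where
        overflow : ∀ τ z {w} → T (X z) → LoadBounded A X a α (τ ∷ʳ z) → w ∈ cache A a (τ ∷ʳ z) →
                   w ∈ cache A α (restrict X τ) → w ∉ cache A α (restrict X τ ∷ʳ z) → ⊥
        overflow τ z {w} Xz load w∈ w∈B w∉B′ = <-irrefl refl α<α
          where
          B  = cache A α (restrict X τ)
          B′ = cache A α (restrict X τ ∷ʳ z)
          big = cache A a (τ ∷ʳ z)
          z∉B = eviction⇒miss α (restrict X τ) z w∈B w∉B′
          B′⊆big : B′ ⊆ big
          B′⊆big {y} = stable τ X z (Equivalence.to T-≡ Xz) a α α<a (>-nonZero⁻¹ α) (w , (w∈B , w∉B′) , w∈) y
          B⊆big : B ⊆ big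
          B⊆big {v} v∈B with v ∈? B′
          ... | yes v∈B′ = B′⊆big v∈B′
          ... | no v∉B′  = subst (_∈ big) (one-out α (restrict X τ) z z∉B w v w∈B w∉B′ v∈B v∉B′) w∈
          z∷B⊆X∩big : z ∷ B ⊆ filterᵇ X big
          z∷B⊆X∩big (here refl) = ∈-filter⁺ (T? ∘ X) (∈-cache-∷ʳ a τ z) Xz
          z∷B⊆X∩big (there v∈B) = ∈-filter⁺ (T? ∘ X) (B⊆big v∈B)
            (proj₂ (∈-filter⁻ (T? ∘ X) {xs = τ} (cache⊆requests α (restrict X τ) v∈B)))
          α<α : α < α
          α<α = begin-strict
            α               ≡⟨ full α (restrict X τ) z z∉B w w∈B w∉B′ ⟨
            length B        <⟨ ≤-refl ⟩
            length (z ∷ B)  ≤⟨ unique-⊆⇒length-≤ (¬Any⇒All¬ _ z∉B ∷ cache-uniq A α (restrict X τ)) z∷B⊆X∩big ⟩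
            countᵇ X big    ≤⟨ load (τ ∷ʳ z) [] (++-identityʳ (τ ∷ʳ z)) ⟩
            α               ∎
        go : ∀ {τ} → Reverse τ → LoadBounded A X a α τ →
             ∀ {w} → w ∈ cache A a τ → T (X w) → w ∈ cache A α (restrict X τ)
        go [] _ w∈ _ = ⊥-elim (empty a _ w∈)
        go (τ ∶ rτ ∶ʳ z) load {w} w∈ Xw with cache-∷ʳ⁻ a τ z w∈
        ... | inj₁ refl = subst (λ t → w ∈ cache A α t) (sym (restrict-∷ʳ-accept X τ Xw)) (∈-cache-∷ʳ α (restrict X τ) w)
        ... | inj₂ w∈aτ with T? (X z)
        ...   | no ¬Xz = subst (λ t → w ∈ cache A α t) (sym (restrict-∷ʳ-reject X τ ¬Xz)) w∈B
          where
          w∈B = go rτ (LoadBounded-∷ʳ⁻ A load) w∈aτ Xw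
        ...   | yes Xz = subst (λ t → w ∈ cache A α t) (sym (restrict-∷ʳ-accept X τ Xz)) w∈B′
          where
          w∈B = go rτ (LoadBounded-∷ʳ⁻ A load) w∈aτ Xw
          w∈B′ : w ∈ cache A α (restrict X τ ∷ʳ z)
          w∈B′ with w ∈? cache A α (restrict X τ ∷ʳ z)
          ... | yes w∈B′ = w∈B′
          ... | no w∉B′  = ⊥-elim (overflow τ z Xz load w∈ w∈B w∉B′)

      saCost-≤-cost : ∀ {q α k' a} .{{_ : NonZero α}} → α < a → k' ≤ a → 1 ≤ k' → ∀ (h : List (Fin q)) σ →
        (∀ τ ρ → τ ++ ρ ≡ σ → ∀ j → countᵇ (inBucket (items σ) h j) (cache A a τ) ≤ α) →
        saCost A q α h σ ≤ cost A k' σ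
      saCost-≤-cost {q} {α} {k'} {a} α<a k'≤a 1≤k' h σ balanced =
        bucket-misses-≤ A X k' α σ (inBucket-functional (items σ) h) dominated [] σ refl
        where
        X : Fin q → U → Bool
        X j = inBucket (items σ) h j
        k'⊆a : ∀ τ → cache A k' τ ⊆ cache A a τ
        k'⊆a τ with m≤n⇒m<n∨m≡n k'≤a
        ... | inj₁ k'<a = cache-inclusion {{>-nonZero 1≤k'}} k'<a τ
        ... | inj₂ refl = id
        dominated : ∀ τ ρ → τ ++ ρ ≡ σ → ∀ j {w} → w ∈ cache A k' τ → T (X j w) → w ∈ cache A α (restrict (X j) τ)
        dominated τ ρ τ++ρ≡σ j w∈ Xw = bucket-inclusion (X j) α<a τ bounded (k'⊆a τ w∈) Xw
          where
          bounded : LoadBounded A (X j) a α τ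
          bounded τ′ ρ′ τ′++ρ′≡τ = balanced τ′ (ρ′ ++ ρ) (trans (sym (++-assoc τ′ ρ′ ρ)) (trans (cong (_++ ρ) τ′++ρ′≡τ) τ++ρ≡σ)) j

      costly-hashes-rare : ∀ d e {q α k' k c D E} .{{_ : NonZero α}} σ → 1 ≤ k' → 0 < q → q ≤ k →
        TailParameters c D E → c + D ≡ suc α → suc α ⊔ k' ≤ q * c →
        k ^ e * (k ^ d + 1) * k ≤ 2 ^ E → length σ ≤ k ^ d →
        countᵇ (λ h → not (saCost A q α h σ ≤ᵇ cost A k' σ + 0)) (allHashes q (length (items σ))) * k ^ e
          ≤ q ^ length (items σ)
      costly-hashes-rare d e {q} {α} {k'} {k} σ 1≤k' q>0 q≤k P c+D≡1+α a≤qc K≤2^E |σ|≤k^d = begin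
        countᵇ costly H * k ^ e       ≤⟨ *-monoˡ-≤ (k ^ e) (countᵇ-mono-≤ costly⇒overloaded H) ⟩
        countᵇ overloaded H * k ^ e   ≤⟨ union-bound (λ τ h → any (overload τ h) (allFin q)) (inits σ) H
                                           (k ^ e) (k ^ d + 1) (q ^ n) (m≤n+m 1 (k ^ d)) |inits|≤ per-prefix ⟩
        q ^ n                         ∎
        where
        a = suc α ⊔ k'
        ys = items σ
        n = length ys
        H = allHashes q n
        costly overloaded : List (Fin q) → Bool
        costly h = not (saCost A q α h σ ≤ᵇ cost A k' σ + 0)
        overload : List U → List (Fin q) → Fin q → Bool
        overload τ h j = not (countᵇ (inBucket ys h j) (cache A a τ) ≤ᵇ α)
        overloaded h = any (λ τ → any (overload τ h) (allFin q)) (inits σ)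
        costly⇒overloaded : ∀ h → T (costly h) → T (overloaded h)
        costly⇒overloaded h costly-h with T? (overloaded h)
        ... | yes ov = ov
        ... | no ¬ov = contradiction (≤-trans (saCost-≤-cost (m≤m⊔n (suc α) k') (m≤n⊔m (suc α) k') 1≤k' h σ balanced)
                                              (≤-reflexive (sym (+-identityʳ _))))
                                     (<⇒≱ (not-≤ᵇ⇒> _ _ costly-h))
          where
          balanced : ∀ τ ρ → τ ++ ρ ≡ σ → ∀ j → countᵇ (inBucket ys h j) (cache A a τ) ≤ α
          balanced τ ρ τ++ρ≡σ j = ≮⇒≥ λ α<load → ¬ov (T-any⁺ (∈-inits τ++ρ≡σ) (T-any⁺ (∈-allFin j) (>⇒not-≤ᵇ α<load)))
        |inits|≤ : length (inits σ) ≤ k ^ d + 1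
        |inits|≤ = ≤-trans (≤-reflexive (length-inits σ)) (≤-trans (s≤s |σ|≤k^d) (≤-reflexive (+-comm 1 (k ^ d))))
        per-prefix : ∀ {τ} → τ ∈ inits σ → countᵇ (λ h → any (overload τ h) (allFin q)) H * (k ^ e * (k ^ d + 1)) ≤ q ^ n
        per-prefix {τ} _ = union-bound (λ j h → overload τ h j) (allFin q) H (k ^ e * (k ^ d + 1)) k (q ^ n)
          (<-≤-trans q>0 q≤k) (≤-trans (≤-reflexive (length-tabulate {n = q} id)) q≤k)
          (λ {j} _ → bucket-tail P j ys (cache A a τ) α _ q>0 (cache-uniq A a τ) (deduplicate-! _≟_ σ)
                       (≤-trans (cache-size A a τ) a≤qc) c+D≡1+α K≤2^E)

      set-associative-competitive : ∀ d e (k α : ℕ) (div : α ∣ k) → 2 ≤ k → α < k →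
        129 * logFactor d e * ⌊log₂ k ⌋ ≤ α →
        ∀ k' → 1 ≤ k' → k' ≤ k →
        128 * logFactor d e * (128 * logFactor d e) * (k' * k') * ⌊log₂ k ⌋ ≤ (k ∸ k') * (k ∸ k') * α →
        ∀ σ → length σ ≤ k ^ d →
        countᵇ (λ h → not (saCost A (_∣_.quotient div) α h σ ≤ᵇ cost A k' σ + 0))
               (allHashes (_∣_.quotient div) (length (items σ))) * k ^ e
          ≤ _∣_.quotient div ^ length (items σ)
      set-associative-competitive d e k α (divides 0 k≡0) 2≤k = contradiction (subst (2 ≤_) k≡0 2≤k) λ ()
      set-associative-competitive d e k α (divides 1 k≡α) _ α<k =
        contradiction (subst (α <_) (trans k≡α (+-identityʳ α)) α<k) (<-irrefl refl)
      set-associative-competitive d e k α (divides q@(suc (suc _)) k≡qα) 2≤k α<k 129WL≤α k' 1≤k' k'≤k dense σ |σ|≤k^d =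
        costly-hashes-rare d e σ 1≤k' (s≤s z≤n) (subst (q ≤_) (sym k≡qα) (m≤m*n q α))
          (tail-parameters c D E (≤-trans (*-monoʳ-≤ 8 1+E≤WL) 8V≤D) (≤-trans (*-monoʳ-≤ (32 * c) 1+E≤WL) 32cV≤D²))
          c+D≡1+α a≤qc (union-weight-≤ k d e (≤-trans (s≤s z≤n) 2≤k)) |σ|≤k^d
        where
        W = logFactor d e
        1≤W : 1 ≤ W
        1≤W = ≤-trans (≤-trans (s≤s z≤n) (m≤n+m 2 (e + d))) (m≤n*m (e + d + 2) 2)
        L = ⌊log₂ k ⌋
        1≤L : 1 ≤ L
        1≤L = ⌊log₂⌋-mono-≤ 2≤k
        E = suc (suc L * (e + d + 1))
        1+E≤WL : suc E ≤ W * L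
        1+E≤WL = union-exponent-≤ L d e 1≤L
        129[WL]≤α : 129 * (W * L) ≤ α
        129[WL]≤α = subst (_≤ α) (*-assoc 129 W L) 129WL≤α
        instance
          α-nonZero : NonZero α
          α-nonZero = >-nonZero (≤-trans (≤-trans (*-mono-≤ 1≤W 1≤L) (m≤n*m (W * L) 129)) 129[WL]≤α)
        open Headroom (share-headroom {q} {α} {k'} {k ∸ k'} (s≤s (s≤s z≤n)) 1≤W 1≤L 129[WL]≤α
                                      (trans (m+[n∸m]≡n k'≤k) k≡qα) dense)
        a = suc α ⊔ k'
        c = suc (a / q)
        a≤qc : a ≤ q * c
        a≤qc = subst (a ≤_) (*-comm (suc (a / q)) q) (<⇒≤ (m<[1+m/n]*n a q))

proposition4 : (U : Set) (_≟U_ : DecidableEquality U) →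
    let open Paging _≟U_ in
    (A : PagingAlg) → Lazy A → Stable A →
    (d e : ℕ) →
    ∃ λ (M : ℕ) → ∃ λ (C : ℕ) → ∃ λ (c₀ : ℕ) → ∃ λ (k₀ : ℕ) →
      ∀ (k α : ℕ) (div : α ∣ k) → k₀ ≤ k → α < k →
      M * ⌊log₂ k ⌋ ≤ α →
      ∀ (k' : ℕ) → 1 ≤ k' → k' ≤ k →
      C * C * (k' * k') * ⌊log₂ k ⌋ ≤ (k ∸ k') * (k ∸ k') * α →
      ∀ (σ : List U) → length σ ≤ k ^ d →
      countᵇ (λ h → not (saCost A (_∣_.quotient div) α h σ ≤ᵇ cost A k' σ + c₀))
             (allHashes (_∣_.quotient div) (length (items σ))) * k ^ e
        ≤ _∣_.quotient div ^ length (items σ)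
proposition4 U _≟U_ A lazy stable d e =
  129 * logFactor d e , 128 * logFactor d e , 0 , 2 , set-associative-competitive _≟U_ A lazy stable d e
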